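{- Let $G=(V,E)$ be a finite connected graph with $|V|=n$. For $I\subseteq V$ let $a(I)=|V\setminus N[I]|=n-|I|-|N(I)|$, and for each independent set $I$ of $G$ define $b(I)$ recursively by $$b(\varnothing)=1,\qquad b(I)=\frac{1}{n-a(I)}\sum_{v\in I} b(I\setminus\{v\})\quad (I\neq\varnothing).$$ Then the number $\sigma(G)$ of successive vertex orderings of $G$ is $$\sigma(G)=n!\sum_{\substack{I\subseteq V\\ I\ \text{independent}}}(-1)^{|I|}\,\frac{a(I)}{n}\,b(I).$$
   Context: A linear ordering of $V$ is a bijection $\pi:V\to\{1,\dots,n\}$. It is successive if every vertex $v$ with $\pi(v)>1$ has a neighbour $u$ with $\pi(u)<\pi(v)$; $\sigma(G)$ is the number of successive linear orderings. For $I\subseteq V$, $N(I)$ is the set of vertices adjacent to at least one vertex of $I$ (open neighbourhood) and $N[I]=I\cup N(I)$ (closed neighbourhood). A set is independent if no two of its vertices are adjacent; the empty set is independent. -}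

module Defs where

open import Data.Nat using (ℕ; zero; suc; _∸_)
import Data.Nat as ℕ
open import Data.Fin using (Fin; zero; suc; _<_; toℕ)
open import Data.Fin.Properties using (all?; any?; _≟_) renaming (_<?_ to _<ᶠ?_)
open import Data.Bool using (Bool; true; false; if_then_else_)
open import Data.Bool.Properties using () renaming (_≟_ to _≟ᵇ_)
open import Data.Vec using (Vec; []; _∷_; lookup; tabulate)
open import Data.List using (List; []; _∷_; [_]; filter; length; concatMap; map; allFin; foldr)
open import Data.Rational using (ℚ; 0ℚ; 1ℚ; _+_; _*_; -_; _/_)
open import Data.Integer using (+_)
open import Data.Fin.Subset using (Subset; inside; outside; _∈_; ∣_∣; _-_; _∪_; ∁)
open import Data.Fin.Subset.Properties using (_∈?_)
open import Data.Product using (Σ; ∃; _×_; _,_)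
open import Relation.Binary.PropositionalEquality using (_≡_; _≢_)
open import Relation.Nullary using (Dec; yes; no; ¬_; ¬?; does)
open import Relation.Nullary.Decidable using (_×-dec_; _→-dec_)

record Graph (n : ℕ) : Set where
  field
    adj    : Fin n → Fin n → Bool
    sym    : ∀ u v → adj u v ≡ adj v u
    irrefl : ∀ v → adj v v ≡ false
open Graph public

Adj : ∀ {n} → Graph n → Fin n → Fin n → Set
Adj G u v = adj G u v ≡ true

Adj? : ∀ {n} (G : Graph n) u v → Dec (Adj G u v)
Adj? G u v = adj G u v ≟ᵇ true

data Walk {n} (G : Graph n) : Fin n → Fin n → Set where
  here : ∀ v → Walk G v v
  step : ∀ {u v w} → Adj G u v → Walk G v w → Walk G u w

Connected : ∀ {n} → Graph n → Set
Connected {n} G = ∀ (u v : Fin n) → Walk G u v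

-- Linear orderings π : V → {1,…,n}, represented 0-based as
-- π : Vec (Fin n) n with π(v) = lookup π v ∈ {0,…,n-1}.

Ordering : ℕ → Set
Ordering n = Vec (Fin n) n

IsBijection : ∀ {n} → Ordering n → Set
IsBijection {n} π =
  (∀ (u v : Fin n) → lookup π u ≡ lookup π v → u ≡ v) ×
  (∀ (k : Fin n) → ∃ λ v → lookup π v ≡ k)

-- successive: every v with π(v) > 1 (0-based: π(v) ≠ 0) has a
-- neighbour u with π(u) < π(v)
IsSuccessive : ∀ {n} → Graph n → Ordering n → Set
IsSuccessive {n} G π =
  ∀ (v : Fin n) → 0 ℕ.< toℕ (lookup π v) →
    ∃ λ (u : Fin n) → Adj G u v × lookup π u < lookup π v

IsBijection? : ∀ {n} (π : Ordering n) → Dec (IsBijection π)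
IsBijection? π =
  all? (λ u → all? (λ v → (lookup π u ≟ lookup π v) →-dec (u ≟ v)))
  ×-dec all? (λ k → any? (λ v → lookup π v ≟ k))

IsSuccessive? : ∀ {n} (G : Graph n) (π : Ordering n) → Dec (IsSuccessive G π)
IsSuccessive? {n} G π =
  all? (λ v → (0 ℕ.<? toℕ (lookup π v)) →-dec
                any? (λ u → Adj? G u v ×-dec (lookup π u <ᶠ? lookup π v)))

allVecs : ∀ n m → List (Vec (Fin n) m)
allVecs n zero    = [ [] ]
allVecs n (suc m) = concatMap (λ x → map (x ∷_) (allVecs n m)) (allFin n)

σ : ∀ {n} → Graph n → ℕ
σ {n} G = length (filter (λ π → IsBijection? π ×-dec IsSuccessive? G π) (allVecs n n))

allSubsets : ∀ n → List (Subset n)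
allSubsets zero    = [ [] ]
allSubsets (suc n) = concatMap (λ s → (inside ∷ s) ∷ (outside ∷ s) ∷ []) (allSubsets n)

fromDec : ∀ {A : Set} → Dec A → Bool
fromDec (yes _) = inside
fromDec (no _)  = outside

N : ∀ {n} → Graph n → Subset n → Subset n
N G I = tabulate (λ v → fromDec (any? (λ u → (u ∈? I) ×-dec Adj? G u v)))

N[_,_] : ∀ {n} → Graph n → Subset n → Subset n
N[ G , I ] = I ∪ N G I

Independent : ∀ {n} → Graph n → Subset n → Set
Independent {n} G I = ∀ (u v : Fin n) → u ∈ I → v ∈ I → ¬ Adj G u v

Independent? : ∀ {n} (G : Graph n) (I : Subset n) → Dec (Independent G I)
Independent? G I =
  all? (λ u → all? (λ v → (u ∈? I) →-dec ((v ∈? I) →-dec ¬? (Adj? G u v))))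

a : ∀ {n} → Graph n → Subset n → ℕ
a G I = ∣ ∁ N[ G , I ] ∣

sumℚ : List ℚ → ℚ
sumℚ = foldr _+_ 0ℚ

-- 1/k for k > 0 (the value at 0 is never used below)
inv : ℕ → ℚ
inv zero    = 0ℚ
inv (suc k) = + 1 / suc k

sgn : ℕ → ℚ
sgn zero    = 1ℚ
sgn (suc k) = - sgn k

ℕtoℚ : ℕ → ℚ
ℕtoℚ k = + k / 1

-- b(I), by recursion on |I| (fuel k = |I|):
--   b(∅) = 1,  b(I) = 1/(n - a(I)) · Σ_{v ∈ I} b(I \ {v})
bAux : ∀ {n} → Graph n → ℕ → Subset n → ℚ
bAux G zero    I = 1ℚ
bAux {n} G (suc k) I =
  inv (n ∸ a G I) * sumℚ (map (λ v → bAux G k (I - v)) (filter (_∈? I) (allFin n)))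

b : ∀ {n} → Graph n → Subset n → ℚ
b G I = bAux G ∣ I ∣ I

alternatingSum : ∀ {m} → Graph (suc m) → ℚ
alternatingSum {m} G =
  sumℚ (map (λ I → sgn ∣ I ∣ * ((+ a G I / suc m) * b G I))
            (filter (Independent? G) (allSubsets (suc m))))

{-# OPTIONS --safe #-}

-- Write an ordering as its first vertex x followed by an arrangement w of the other vertices, and
-- call a vertex of w lonely if none of its neighbours precedes it.  The ordering is successive iff
-- no vertex is lonely, and the lonely vertices form an independent set, so inclusion–exclusion gives
-- σ(G) = Σ_I (-1)^|I| #{(x, w) : x ∉ I and every vertex of I is lonely}, over independent sets I.
-- No w qualifies when x ∈ N(I), and for each of the a(I) vertices x ∉ N[I] there are (n-1)! b(I).
-- That count holds for any set W of k vertices with N[I] ⊆ W, arranged after the vertices outside W: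
-- if the first vertex y of W lies in I the rest can be arranged in (k-1)! b(I - y) ways, if
-- y ∈ N(I) ∖ I in none, and for each of the k - |N[I]| other choices in (k-1)! b(I) ways; the
-- recursion |N[I]| b(I) = Σ_{v ∈ I} b(I - v) defining b closes the induction.  Finally
-- a(I) (n-1)! = n! a(I)/n.

module Submission where

open import Defs
open import Data.Nat using (ℕ; suc)
open import Data.Nat using (_!)
open import Data.Rational using (ℚ; _*_)
open import Relation.Binary.PropositionalEquality using (_≡_)

open import Data.Bool using (Bool; true; false; _∧_; _∨_; not; if_then_else_)
open import Data.Bool.Properties
  using (∧-zeroʳ; ∧-identityʳ; ∨-zeroʳ; ∨-identityʳ; ∧-conicalˡ; ∧-conicalʳ; not-¬; ¬-not; not-injective)
open import Data.Nat as ℕ using (zero; _∸_)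
import Data.Nat.Properties as ℕ
open import Data.Nat.DivMod using (_mod_)
import Data.Nat.DivMod as ℕ
import Data.Nat.Coprimality as Coprime
import Data.Integer as ℤ
import Data.Integer.Properties as ℤ
open import Data.Rational as ℚ using (mkℚ; 0ℚ; 1ℚ; _+_; _/_)
import Data.Rational.Properties as ℚ
open import Data.Rational.Solver using (module +-*-Solver)
open import Data.List using (List; []; _∷_; map; _++_; concatMap; filter; length; allFin)
import Data.List as List using (tabulate)
import Data.List.Properties as Listₚ
open import Data.List.Membership.Propositional using () renaming (_∈_ to _∈ₗ_; _∉_ to _∉ₗ_)
open import Data.List.Relation.Unary.Any using (here; there)
open import Data.List.Relation.Unary.All using ([])
import Data.List.Relation.Unary.All as All
import Data.List.Relation.Unary.All.Properties as All
open import Data.List.Relation.Unary.Unique.Propositional using (Unique; []; _∷_)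
import Data.List.Relation.Unary.Unique.Propositional.Properties as Unique
open import Data.List.Membership.Propositional.Properties.WithK using (unique∧set⇒bag)
open import Data.List.Relation.Binary.BagAndSetEquality using (∼bag⇒↭)
open import Data.List.Relation.Binary.Permutation.Propositional.Properties using (↭-length)
open import Data.List.Membership.Propositional.Properties
  using (∈-map⁺; ∈-map⁻; ∈-filter⁺; ∈-filter⁻; ∈-allFin; ∈-tabulate⁺; ∈-concat⁺′; ∈-concat⁻′)
open import Data.Fin using (Fin; zero; suc; toℕ)
open import Data.Fin.Properties using (_≟_; any?)
import Data.Fin.Properties as Fin
open import Data.Fin.Subset using (Subset; ⊤; ⊥; ⁅_⁆; ∁; _∪_; _─_; _-_; ∣_∣)
import Data.Fin.Subset.Properties as Subset
open import Data.Fin.Subset.Properties using (_∈?_)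
open import Data.Vec using (Vec; []; _∷_; lookup)
import Data.Vec as Vec using (tabulate)
import Data.Vec.Properties as Vecₚ
open import Data.Product using (∃; _×_; _,_; proj₁; proj₂)
open import Data.Sum using (_⊎_; inj₁; inj₂)
open import Data.Empty using (⊥-elim)
open import Function using (_∘_)
open import Function.Bundles using (mk⇔)
open import Relation.Nullary using (Dec; does; yes; no; ¬_)
open import Relation.Nullary.Decidable using (_×-dec_; dec-true)
open import Relation.Unary using (Decidable)
open import Relation.Binary.PropositionalEquality as ≡ using (_≢_; refl; trans; cong; cong₂; module ≡-Reasoning)

open +-*-Solver

ℕtoℚ≡mkℚ : ∀ k → ℕtoℚ k ≡ mkℚ (ℤ.+ k) 0 (Coprime.sym (Coprime.1-coprimeTo k))
ℕtoℚ≡mkℚ k = ℚ.normalize-coprime (Coprime.sym (Coprime.1-coprimeTo k))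

inv≡mkℚ : ∀ k → inv (suc k) ≡ mkℚ (ℤ.+ 1) k (Coprime.1-coprimeTo (suc k))
inv≡mkℚ k = ℚ.normalize-coprime (Coprime.1-coprimeTo (suc k))

ℕtoℚ-+ : ∀ i j → ℕtoℚ (i ℕ.+ j) ≡ ℕtoℚ i + ℕtoℚ j
ℕtoℚ-+ i j rewrite ℕtoℚ≡mkℚ i | ℕtoℚ≡mkℚ j =
  ℚ./-cong {p₁ = ℤ.+ (i ℕ.+ j)}
    (trans (ℤ.pos-+ i j) (≡.sym (cong₂ ℤ._+_ (ℤ.*-identityʳ (ℤ.+ i)) (ℤ.*-identityʳ (ℤ.+ j))))) refl

ℕtoℚ-* : ∀ i j → ℕtoℚ (i ℕ.* j) ≡ ℕtoℚ i * ℕtoℚ j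
ℕtoℚ-* i j rewrite ℕtoℚ≡mkℚ i | ℕtoℚ≡mkℚ j = ℚ./-cong {p₁ = ℤ.+ (i ℕ.* j)} (ℤ.pos-* i j) refl

inv-inverseˡ : ∀ k → inv (suc k) * ℕtoℚ (suc k) ≡ 1ℚ
inv-inverseˡ k rewrite inv≡mkℚ k | ℕtoℚ≡mkℚ (suc k) =
  ℚ.*-inverseˡ (mkℚ (ℤ.+ suc k) 0 (Coprime.sym (Coprime.1-coprimeTo (suc k))))

inv-cancel : ∀ k q → 0 ℕ.< k → ℕtoℚ k * (inv k * q) ≡ q
inv-cancel (suc k) q _ = begin
  ℕtoℚ (suc k) * (inv (suc k) * q)   ≡⟨ ≡.sym (ℚ.*-assoc (ℕtoℚ (suc k)) _ q) ⟩
  ℕtoℚ (suc k) * inv (suc k) * q     ≡⟨ cong (_* q) (trans (ℚ.*-comm (ℕtoℚ (suc k)) _) (inv-inverseˡ k)) ⟩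
  1ℚ * q                             ≡⟨ ℚ.*-identityˡ q ⟩
  q                                  ∎
  where open ≡-Reasoning

/suc≡*inv : ∀ i k → ℤ.+ i / suc k ≡ ℕtoℚ i * inv (suc k)
/suc≡*inv i k rewrite inv≡mkℚ k | ℕtoℚ≡mkℚ i =
  ℚ./-cong {p₁ = ℤ.+ i} (≡.sym (ℤ.*-identityʳ (ℤ.+ i))) (≡.sym (ℕ.+-identityʳ (suc k)))

alternating-term : ∀ m s i y →
  ℕtoℚ (suc m !) * (s * ((ℤ.+ i / suc m) * y)) ≡ s * (ℕtoℚ (m !) * (ℕtoℚ i * y))
alternating-term m s i y = begin
  ℕtoℚ (suc m !) * (s * ((ℤ.+ i / suc m) * y))
    ≡⟨ cong₂ (λ f q → f * (s * (q * y))) (ℕtoℚ-* (suc m) (m !)) (/suc≡*inv i m) ⟩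
  ℕtoℚ (suc m) * ℕtoℚ (m !) * (s * (ℕtoℚ i * inv (suc m) * y))
    ≡⟨ solve 6 (λ M F s I J y → M :* F :* (s :* (I :* J :* y)) := (J :* M) :* (s :* (F :* (I :* y))))
             refl (ℕtoℚ (suc m)) (ℕtoℚ (m !)) s (ℕtoℚ i) (inv (suc m)) y ⟩
  (inv (suc m) * ℕtoℚ (suc m)) * (s * (ℕtoℚ (m !) * (ℕtoℚ i * y)))
    ≡⟨ trans (cong (_* (s * (ℕtoℚ (m !) * (ℕtoℚ i * y)))) (inv-inverseˡ m)) (ℚ.*-identityˡ _) ⟩
  s * (ℕtoℚ (m !) * (ℕtoℚ i * y)) ∎
  where open ≡-Reasoning

∑ : {A : Set} → List A → (A → ℚ) → ℚ
∑ xs f = sumℚ (map f xs)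

syntax ∑ xs (λ x → e) = ∑[ x ∈ xs ] e

∑-cong-∈ : ∀ {A : Set} (xs : List A) {f g : A → ℚ} →
           (∀ {x} → x ∈ₗ xs → f x ≡ g x) → ∑ xs f ≡ ∑ xs g
∑-cong-∈ []       f≡g = refl
∑-cong-∈ (x ∷ xs) f≡g = cong₂ _+_ (f≡g (here refl)) (∑-cong-∈ xs (f≡g ∘ there))

∑-cong : ∀ {A : Set} (xs : List A) {f g : A → ℚ} → (∀ x → f x ≡ g x) → ∑ xs f ≡ ∑ xs g
∑-cong xs f≡g = ∑-cong-∈ xs (λ {x} _ → f≡g x)

∑-++ : ∀ {A : Set} (xs ys : List A) (f : A → ℚ) → ∑ (xs ++ ys) f ≡ ∑ xs f + ∑ ys f
∑-++ []       ys f = ≡.sym (ℚ.+-identityˡ (∑ ys f))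
∑-++ (x ∷ xs) ys f = trans (cong (f x +_) (∑-++ xs ys f)) (≡.sym (ℚ.+-assoc (f x) _ _))

∑-0 : ∀ {A : Set} (xs : List A) → ∑[ x ∈ xs ] 0ℚ ≡ 0ℚ
∑-0 []       = refl
∑-0 (x ∷ xs) = trans (ℚ.+-identityˡ _) (∑-0 xs)

∑-distrib-+ : ∀ {A : Set} (xs : List A) (f g : A → ℚ) → ∑[ x ∈ xs ] (f x + g x) ≡ ∑ xs f + ∑ xs g
∑-distrib-+ []       f g = refl
∑-distrib-+ (x ∷ xs) f g rewrite ∑-distrib-+ xs f g =
  solve 4 (λ a b c d → (a :+ b) :+ (c :+ d) := (a :+ c) :+ (b :+ d)) refl (f x) (g x) (∑ xs f) (∑ xs g)

*-distribˡ-∑ : ∀ {A : Set} (c : ℚ) (xs : List A) (f : A → ℚ) → c * ∑ xs f ≡ ∑[ x ∈ xs ] (c * f x)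
*-distribˡ-∑ c []       f = ℚ.*-zeroʳ c
*-distribˡ-∑ c (x ∷ xs) f = trans (ℚ.*-distribˡ-+ c (f x) (∑ xs f)) (cong (c * f x +_) (*-distribˡ-∑ c xs f))

*-distribʳ-∑ : ∀ {A : Set} (c : ℚ) (xs : List A) (f : A → ℚ) → ∑ xs f * c ≡ ∑[ x ∈ xs ] (f x * c)
*-distribʳ-∑ c xs f = trans (ℚ.*-comm (∑ xs f) c)
                            (trans (*-distribˡ-∑ c xs f) (∑-cong xs (λ x → ℚ.*-comm c (f x))))

∑-comm : ∀ {A B : Set} (xs : List A) (ys : List B) (f : A → B → ℚ) →
         ∑[ x ∈ xs ] ∑[ y ∈ ys ] f x y ≡ ∑[ y ∈ ys ] ∑[ x ∈ xs ] f x y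
∑-comm []       ys f = ≡.sym (∑-0 ys)
∑-comm (x ∷ xs) ys f = trans (cong (∑ ys (f x) +_) (∑-comm xs ys f))
                             (≡.sym (∑-distrib-+ ys (f x) (λ y → ∑[ x ∈ xs ] f x y)))

∑-map : ∀ {A B : Set} (g : A → B) (xs : List A) (f : B → ℚ) → ∑ (map g xs) f ≡ ∑ xs (f ∘ g)
∑-map g []       f = refl
∑-map g (x ∷ xs) f = cong (f (g x) +_) (∑-map g xs f)

∑-concatMap : ∀ {A B : Set} (g : A → List B) (xs : List A) (f : B → ℚ) →
              ∑ (concatMap g xs) f ≡ ∑[ x ∈ xs ] ∑ (g x) f
∑-concatMap g []       f = refl
∑-concatMap g (x ∷ xs) f = trans (∑-++ (g x) (concatMap g xs) f) (cong (∑ (g x) f +_) (∑-concatMap g xs f))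

∑-allFin-suc : ∀ {n} (f : Fin (suc n) → ℚ) → ∑ (allFin (suc n)) f ≡ f zero + ∑ (allFin n) (f ∘ suc)
∑-allFin-suc f = cong (λ xs → f zero + sumℚ xs)
  (trans (Listₚ.map-tabulate suc f) (≡.sym (Listₚ.map-tabulate (λ i → i) (f ∘ suc))))

𝟙 : Bool → ℚ
𝟙 true  = 1ℚ
𝟙 false = 0ℚ

𝟙-∧ : ∀ x y → 𝟙 (x ∧ y) ≡ 𝟙 x * 𝟙 y
𝟙-∧ true  y = ≡.sym (ℚ.*-identityˡ (𝟙 y))
𝟙-∧ false y = ≡.sym (ℚ.*-zeroˡ (𝟙 y))

∨-true⁻ : ∀ {x y} → x ∨ y ≡ true → x ≡ true ⊎ y ≡ true
∨-true⁻ {true}  _ = inj₁ refl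
∨-true⁻ {false} y = inj₂ y

≡-by-truth : ∀ {x y} → (x ≡ true → y ≡ true) → (y ≡ true → x ≡ true) → x ≡ y
≡-by-truth {true}  {true}  _   _   = refl
≡-by-truth {true}  {false} x⇒y _   = ≡.sym (x⇒y refl)
≡-by-truth {false} {true}  _   y⇒x = y⇒x refl
≡-by-truth {false} {false} _   _   = refl

does-true⁻ : ∀ {A : Set} (d : Dec A) → does d ≡ true → A
does-true⁻ (yes a) _ = a

fromDec≡does : ∀ {A : Set} (d : Dec A) → fromDec d ≡ does d
fromDec≡does (yes _) = refl
fromDec≡does (no _)  = refl

𝟙-does-*-cong : ∀ {A : Set} (d : Dec A) {x y} → (A → x ≡ y) → 𝟙 (does d) * x ≡ 𝟙 (does d) * y
𝟙-does-*-cong (yes a) x≡y = cong (1ℚ *_) (x≡y a)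
𝟙-does-*-cong (no _)  {x} {y} _ = trans (ℚ.*-zeroˡ x) (≡.sym (ℚ.*-zeroˡ y))

∑-filter : ∀ {A : Set} {P : A → Set} (P? : Decidable P) (xs : List A) (f : A → ℚ) →
           ∑ (filter P? xs) f ≡ ∑[ x ∈ xs ] (𝟙 (does (P? x)) * f x)
∑-filter P? []       f = refl
∑-filter P? (x ∷ xs) f with does (P? x)
... | true  = cong₂ _+_ (≡.sym (ℚ.*-identityˡ (f x))) (∑-filter P? xs f)
... | false = trans (∑-filter P? xs f) (≡.sym (trans (cong (_+ _) (ℚ.*-zeroˡ (f x))) (ℚ.+-identityˡ _)))

length-filter : ∀ {A : Set} {P : A → Set} (P? : Decidable P) (xs : List A) →
                ℕtoℚ (length (filter P? xs)) ≡ ∑[ x ∈ xs ] 𝟙 (does (P? x))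
length-filter P? []       = refl
length-filter P? (x ∷ xs) with does (P? x)
... | true  = trans (ℕtoℚ-+ 1 (length (filter P? xs))) (cong (1ℚ +_) (length-filter P? xs))
... | false = trans (length-filter P? xs) (≡.sym (ℚ.+-identityˡ _))

∈-concatMap⁺ : ∀ {A B : Set} (f : A → List B) {xs x y} → x ∈ₗ xs → y ∈ₗ f x → y ∈ₗ concatMap f xs
∈-concatMap⁺ f x∈xs y∈fx = ∈-concat⁺′ y∈fx (∈-map⁺ f x∈xs)

∈-concatMap⁻ : ∀ {A B : Set} (f : A → List B) xs {y} →
               y ∈ₗ concatMap f xs → ∃ λ x → x ∈ₗ xs × y ∈ₗ f x
∈-concatMap⁻ f xs y∈ with ∈-concat⁻′ (map f xs) y∈
... | ys , y∈ys , ys∈ with ∈-map⁻ f ys∈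
...   | x , x∈xs , refl = x , x∈xs , y∈ys

Unique-concatMap : ∀ {A B : Set} (f : A → List B) {xs} → Unique xs → (∀ x → Unique (f x)) →
                   (∀ {x y z} → z ∈ₗ f x → z ∈ₗ f y → x ≡ y) → Unique (concatMap f xs)
Unique-concatMap f {[]}     []            _        _        = []
Unique-concatMap f {x ∷ xs} (x∉xs ∷ !xs) !f disjoint =
  Unique.++⁺ (!f x) (Unique-concatMap f !xs !f disjoint) separate
  where
  separate : ∀ {z} → ¬ (z ∈ₗ f x × z ∈ₗ concatMap f xs)
  separate (z∈fx , z∈rest) with ∈-concatMap⁻ f xs z∈rest
  ... | y , y∈xs , z∈fy with disjoint z∈fx z∈fy
  ...   | refl = All.lookup x∉xs y∈xs refl

Unique-map-on : ∀ {A B : Set} (f : A → B) {xs} →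
                (∀ {x y} → x ∈ₗ xs → y ∈ₗ xs → f x ≡ f y → x ≡ y) → Unique xs → Unique (map f xs)
Unique-map-on f         _          []            = []
Unique-map-on f {x ∷ xs} f-injective (x∉xs ∷ !xs) =
  All.map⁺ (All.tabulate λ y∈xs fx≡fy →
    All.lookup x∉xs y∈xs (f-injective (here refl) (there y∈xs) fx≡fy))
  ∷ Unique-map-on f (λ x∈ y∈ → f-injective (there x∈) (there y∈)) !xs

unique-length : ∀ {A : Set} {xs ys : List A} → Unique xs → Unique ys →
                (∀ {z} → z ∈ₗ xs → z ∈ₗ ys) → (∀ {z} → z ∈ₗ ys → z ∈ₗ xs) →
                length xs ≡ length ys
unique-length !xs !ys xs⊆ys ys⊆xs = ↭-length (∼bag⇒↭ (unique∧set⇒bag !xs !ys (mk⇔ xs⊆ys ys⊆xs)))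

-- Subsets, through their characteristic functions lookup p

lookup-∪ : ∀ {n} (p q : Subset n) i → lookup (p ∪ q) i ≡ lookup p i ∨ lookup q i
lookup-∪ p q i = Vecₚ.lookup-zipWith _∨_ i p q

lookup-∁ : ∀ {n} (p : Subset n) i → lookup (∁ p) i ≡ not (lookup p i)
lookup-∁ p i = Vecₚ.lookup-map i not p

lookup-⊤ : ∀ {n} (i : Fin n) → lookup ⊤ i ≡ true
lookup-⊤ i = Vecₚ.lookup-replicate i true

lookup-⁅⁆ : ∀ {n} (x i : Fin n) → lookup ⁅ x ⁆ i ≡ does (i ≟ x)
lookup-⁅⁆ zero    zero    = refl
lookup-⁅⁆ zero    (suc i) = Vecₚ.lookup-replicate i false
lookup-⁅⁆ (suc x) zero    = refl
lookup-⁅⁆ (suc x) (suc i) = lookup-⁅⁆ x i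

lookup-⁅x⁆-x : ∀ {n} (x : Fin n) → lookup ⁅ x ⁆ x ≡ true
lookup-⁅x⁆-x zero    = refl
lookup-⁅x⁆-x (suc x) = lookup-⁅x⁆-x x

lookup-⁅⁆⁻ : ∀ {n} {x i : Fin n} → lookup ⁅ x ⁆ i ≡ true → i ≡ x
lookup-⁅⁆⁻ {x = x} {i} i∈⁅x⁆ with i ≟ x | lookup-⁅⁆ x i
... | yes i≡x | _     = i≡x
... | no _    | i∉⁅x⁆ = ⊥-elim (not-¬ i∈⁅x⁆ i∉⁅x⁆)

lookup-─ : ∀ {n} (p q : Subset n) i → lookup (p ─ q) i ≡ lookup p i ∧ not (lookup q i)
lookup-─ (s ∷ p) (true  ∷ q) zero    = ≡.sym (∧-zeroʳ s)
lookup-─ (s ∷ p) (false ∷ q) zero    = ≡.sym (∧-identityʳ s)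
lookup-─ (s ∷ p) (t     ∷ q) (suc i) = lookup-─ p q i

lookup-−-self : ∀ {n} (p : Subset n) x → lookup (p - x) x ≡ false
lookup-−-self (s ∷ p) zero    = refl
lookup-−-self (s ∷ p) (suc x) = lookup-−-self p x

lookup-−-other : ∀ {n} (p : Subset n) {x i} → i ≢ x → lookup (p - x) i ≡ lookup p i
lookup-−-other (s ∷ p) {zero}  {zero}  i≢x = ⊥-elim (i≢x refl)
lookup-−-other (s ∷ p) {zero}  {suc i} i≢x = cong (λ q → lookup q i) (Subset.p─⊥≡p p)
lookup-−-other (s ∷ p) {suc x} {zero}  i≢x = refl
lookup-−-other (s ∷ p) {suc x} {suc i} i≢x = lookup-−-other p (i≢x ∘ cong suc)

lookup-−⁻ : ∀ {n} (p : Subset n) {x i} → lookup (p - x) i ≡ true → lookup p i ≡ true × i ≢ x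
lookup-−⁻ p {x} {i} i∈p-x with i ≟ x
... | yes refl = ⊥-elim (not-¬ i∈p-x (lookup-−-self p x))
... | no i≢x   = trans (≡.sym (lookup-−-other p i≢x)) i∈p-x , i≢x

∁-─ : ∀ {n} (p q : Subset n) → ∁ (p ─ q) ≡ ∁ p ∪ q
∁-─ []      []          = refl
∁-─ (s ∷ p) (true  ∷ q) = cong₂ _∷_ (≡.sym (∨-zeroʳ (not s))) (∁-─ p q)
∁-─ (s ∷ p) (false ∷ q) = cong₂ _∷_ (≡.sym (∨-identityʳ (not s))) (∁-─ p q)

∁[⊤-x]≡⁅x⁆ : ∀ {n} (x : Fin n) → ∁ (⊤ - x) ≡ ⁅ x ⁆
∁[⊤-x]≡⁅x⁆ {n} x = begin
  ∁ (⊤ - x)     ≡⟨ ∁-─ ⊤ ⁅ x ⁆ ⟩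
  ∁ ⊤ ∪ ⁅ x ⁆   ≡⟨ cong (_∪ ⁅ x ⁆) (Vecₚ.map-replicate not true n) ⟩
  ⊥ ∪ ⁅ x ⁆     ≡⟨ Subset.∪-identityˡ ⁅ x ⁆ ⟩
  ⁅ x ⁆         ∎
  where open ≡-Reasoning

does-∈? : ∀ {n} (x : Fin n) (p : Subset n) → does (x ∈? p) ≡ lookup p x
does-∈? zero    (true  ∷ p) = refl
does-∈? zero    (false ∷ p) = refl
does-∈? (suc x) (s     ∷ p) = does-∈? x p

∑-filter-∈? : ∀ {n} (p : Subset n) (f : Fin n → ℚ) →
              ∑ (filter (_∈? p) (allFin n)) f ≡ ∑[ x ∈ allFin n ] (𝟙 (lookup p x) * f x)
∑-filter-∈? p f = trans (∑-filter (_∈? p) (allFin _) f)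
                        (∑-cong (allFin _) (λ x → cong (λ b → 𝟙 b * f x) (does-∈? x p)))

∈-filter-∈?⁺ : ∀ {n} {p : Subset n} {x} → lookup p x ≡ true → x ∈ₗ filter (_∈? p) (allFin n)
∈-filter-∈?⁺ {p = p} {x} x∈p = ∈-filter⁺ (_∈? p) (∈-allFin x) (Vecₚ.lookup⇒[]= x p x∈p)

∈-filter-∈?⁻ : ∀ {n} {p : Subset n} {x} → x ∈ₗ filter (_∈? p) (allFin n) → lookup p x ≡ true
∈-filter-∈?⁻ {p = p} x∈ = Vecₚ.[]=⇒lookup (proj₂ (∈-filter⁻ (_∈? p) {xs = allFin _} x∈))

∣p∣≡∑ : ∀ {n} (p : Subset n) → ℕtoℚ ∣ p ∣ ≡ ∑[ i ∈ allFin n ] 𝟙 (lookup p i)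
∣p∣≡∑ []          = refl
∣p∣≡∑ (true  ∷ p) = trans (ℕtoℚ-+ 1 ∣ p ∣)
  (trans (cong (1ℚ +_) (∣p∣≡∑ p)) (≡.sym (∑-allFin-suc (𝟙 ∘ lookup (true ∷ p)))))
∣p∣≡∑ (false ∷ p) = trans (∣p∣≡∑ p)
  (trans (≡.sym (ℚ.+-identityˡ _)) (≡.sym (∑-allFin-suc (𝟙 ∘ lookup (false ∷ p)))))

x∈p⇒1+∣p-x∣≡∣p∣ : ∀ {n} (p : Subset n) x → lookup p x ≡ true → suc ∣ p - x ∣ ≡ ∣ p ∣
x∈p⇒1+∣p-x∣≡∣p∣ (true  ∷ p) zero    _   = cong (suc ∘ ∣_∣) (Subset.p─⊥≡p p)
x∈p⇒1+∣p-x∣≡∣p∣ (true  ∷ p) (suc x) x∈p = cong suc (x∈p⇒1+∣p-x∣≡∣p∣ p x x∈p)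
x∈p⇒1+∣p-x∣≡∣p∣ (false ∷ p) (suc x) x∈p = x∈p⇒1+∣p-x∣≡∣p∣ p x x∈p

∣p-x∣≡k : ∀ {n k} (p : Subset n) x → lookup p x ≡ true → ∣ p ∣ ≡ suc k → ∣ p - x ∣ ≡ k
∣p-x∣≡k p x x∈p ∣p∣≡1+k = ℕ.suc-injective (trans (x∈p⇒1+∣p-x∣≡∣p∣ p x x∈p) ∣p∣≡1+k)

∣⊤-x∣≡m : ∀ {m} (x : Fin (suc m)) → ∣ ⊤ - x ∣ ≡ m
∣⊤-x∣≡m {m} x = ∣p-x∣≡k ⊤ x (lookup-⊤ x) (Subset.∣⊤∣≡n (suc m))

∣p∣≡0⇒lookup≡false : ∀ {n} (p : Subset n) → ∣ p ∣ ≡ 0 → ∀ i → lookup p i ≡ false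
∣p∣≡0⇒lookup≡false (false ∷ p) ∣p∣≡0 zero    = refl
∣p∣≡0⇒lookup≡false (false ∷ p) ∣p∣≡0 (suc i) = ∣p∣≡0⇒lookup≡false p ∣p∣≡0 i

lookup≡false⇒∣p∣≡0 : ∀ {n} (p : Subset n) → (∀ i → lookup p i ≡ false) → ∣ p ∣ ≡ 0
lookup≡false⇒∣p∣≡0 []      _ = refl
lookup≡false⇒∣p∣≡0 (s ∷ p) p≡⊥ rewrite p≡⊥ zero = lookup≡false⇒∣p∣≡0 p (p≡⊥ ∘ suc)

_⊆_ : ∀ {n} → Subset n → Subset n → Set
p ⊆ q = ∀ i → lookup p i ≡ true → lookup q i ≡ true

drop-∷-⊆ : ∀ {n s t} {p q : Subset n} → (s ∷ p) ⊆ (t ∷ q) → p ⊆ q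
drop-∷-⊆ s∷p⊆t∷q i = s∷p⊆t∷q (suc i)

⊆-trans : ∀ {n} (p q r : Subset n) → p ⊆ q → q ⊆ r → p ⊆ r
⊆-trans p q r p⊆q q⊆r i i∈p = q⊆r i (p⊆q i i∈p)

p⊆p∪q : ∀ {n} (p q : Subset n) → p ⊆ (p ∪ q)
p⊆p∪q p q i i∈p = trans (lookup-∪ p q i) (cong (_∨ lookup q i) i∈p)

q⊆p∪q : ∀ {n} (p q : Subset n) → q ⊆ (p ∪ q)
q⊆p∪q p q i i∈q = trans (lookup-∪ p q i) (trans (cong (lookup p i ∨_) i∈q) (∨-zeroʳ (lookup p i)))

x∈p∪⁅x⁆ : ∀ {n} (p : Subset n) x → lookup (p ∪ ⁅ x ⁆) x ≡ true
x∈p∪⁅x⁆ p x = trans (lookup-∪ p ⁅ x ⁆ x) (trans (cong (lookup p x ∨_) (lookup-⁅x⁆-x x)) (∨-zeroʳ _))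

lookup-∪⁅⁆⁻ : ∀ {n} (p : Subset n) {x i} →
              lookup (p ∪ ⁅ x ⁆) i ≡ true → lookup p i ≡ true ⊎ i ≡ x
lookup-∪⁅⁆⁻ p {x} {i} i∈ with ∨-true⁻ (trans (≡.sym (lookup-∪ p ⁅ x ⁆ i)) i∈)
... | inj₁ i∈p     = inj₁ i∈p
... | inj₂ i∈⁅x⁆ = inj₂ (lookup-⁅⁆⁻ i∈⁅x⁆)

p-x⊆p : ∀ {n} (p : Subset n) x → (p - x) ⊆ p
p-x⊆p p x i i∈p-x = proj₁ (lookup-−⁻ p i∈p-x)

⊆-− : ∀ {n} (p q : Subset n) x → p ⊆ q → lookup p x ≡ false → p ⊆ (q - x)
⊆-− p q x p⊆q x∉p i i∈p = trans (lookup-−-other q (λ { refl → not-¬ i∈p x∉p })) (p⊆q i i∈p)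

⊆-lookup-false : ∀ {n} (p q : Subset n) → p ⊆ q → ∀ i → lookup q i ≡ false → lookup p i ≡ false
⊆-lookup-false p q p⊆q i i∉q = ¬-not (λ i∈p → not-¬ (p⊆q i i∈p) i∉q)

∣p─q∣+∣q∣≡∣p∣ : ∀ {n} (p q : Subset n) → q ⊆ p → ∣ p ─ q ∣ ℕ.+ ∣ q ∣ ≡ ∣ p ∣
∣p─q∣+∣q∣≡∣p∣ []          []          _   = refl
∣p─q∣+∣q∣≡∣p∣ (true  ∷ p) (true  ∷ q) q⊆p =
  trans (ℕ.+-suc ∣ p ─ q ∣ ∣ q ∣) (cong suc (∣p─q∣+∣q∣≡∣p∣ p q (drop-∷-⊆ q⊆p)))
∣p─q∣+∣q∣≡∣p∣ (false ∷ p) (true  ∷ q) q⊆p with () ← q⊆p zero refl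
∣p─q∣+∣q∣≡∣p∣ (true  ∷ p) (false ∷ q) q⊆p = cong suc (∣p─q∣+∣q∣≡∣p∣ p q (drop-∷-⊆ q⊆p))
∣p─q∣+∣q∣≡∣p∣ (false ∷ p) (false ∷ q) q⊆p = ∣p─q∣+∣q∣≡∣p∣ p q (drop-∷-⊆ q⊆p)

_⊆ᵇ_ : ∀ {n} → Subset n → Subset n → Bool
[]      ⊆ᵇ []      = true
(s ∷ p) ⊆ᵇ (t ∷ q) = (not s ∨ t) ∧ (p ⊆ᵇ q)

⊆ᵇ-sound : ∀ {n} (p q : Subset n) → p ⊆ᵇ q ≡ true → p ⊆ q
⊆ᵇ-sound (true ∷ p) (t ∷ q) p⊆q zero    _ = ∧-conicalˡ t _ p⊆q
⊆ᵇ-sound (s    ∷ p) (t ∷ q) p⊆q (suc i)   = ⊆ᵇ-sound p q (∧-conicalʳ (not s ∨ t) _ p⊆q) i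

⊆ᵇ-complete : ∀ {n} (p q : Subset n) → p ⊆ q → p ⊆ᵇ q ≡ true
⊆ᵇ-complete []          []      _   = refl
⊆ᵇ-complete (true  ∷ p) (t ∷ q) p⊆q rewrite p⊆q zero refl = ⊆ᵇ-complete p q (drop-∷-⊆ p⊆q)
⊆ᵇ-complete (false ∷ p) (t ∷ q) p⊆q = ⊆ᵇ-complete p q (drop-∷-⊆ p⊆q)

⊆ᵇ-⊤-x : ∀ {n} (I : Subset n) x → I ⊆ᵇ (⊤ - x) ≡ not (lookup I x)
⊆ᵇ-⊤-x I x = ≡-by-truth
  (λ I⊆⊤-x → cong not (⊆-lookup-false I (⊤ - x) (⊆ᵇ-sound I (⊤ - x) I⊆⊤-x) x (lookup-−-self ⊤ x)))
  (λ x∉I → ⊆ᵇ-complete I (⊤ - x) (⊆-− I ⊤ x (λ i _ → lookup-⊤ i) (not-injective x∉I)))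

emptyᵇ : ∀ {n} → Subset n → Bool
emptyᵇ []      = true
emptyᵇ (s ∷ p) = not s ∧ emptyᵇ p

emptyᵇ-sound : ∀ {n} (p : Subset n) → emptyᵇ p ≡ true → ∀ i → lookup p i ≡ false
emptyᵇ-sound (false ∷ p) _ zero    = refl
emptyᵇ-sound (s     ∷ p) e (suc i) = emptyᵇ-sound p (∧-conicalʳ (not s) _ e) i

emptyᵇ-complete : ∀ {n} (p : Subset n) → (∀ i → lookup p i ≡ false) → emptyᵇ p ≡ true
emptyᵇ-complete []      _   = refl
emptyᵇ-complete (s ∷ p) p≡⊥ rewrite p≡⊥ zero = emptyᵇ-complete p (p≡⊥ ∘ suc)

inclusion-exclusion : ∀ n (L : Subset n) →
                      ∑[ I ∈ allSubsets n ] (sgn ∣ I ∣ * 𝟙 (I ⊆ᵇ L)) ≡ 𝟙 (emptyᵇ L)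
inclusion-exclusion zero    []      = refl
inclusion-exclusion (suc n) (t ∷ L) = begin
  ∑[ I ∈ allSubsets (suc n) ] (sgn ∣ I ∣ * 𝟙 (I ⊆ᵇ (t ∷ L)))
    ≡⟨ ∑-concatMap (λ I → (true ∷ I) ∷ (false ∷ I) ∷ []) (allSubsets n) _ ⟩
  ∑[ I ∈ allSubsets n ] (ℚ.- sgn ∣ I ∣ * 𝟙 (t ∧ (I ⊆ᵇ L)) + (sgn ∣ I ∣ * 𝟙 (I ⊆ᵇ L) + 0ℚ))
    ≡⟨ ∑-cong (allSubsets n) (λ I → cancel t (sgn ∣ I ∣) (I ⊆ᵇ L)) ⟩
  ∑[ I ∈ allSubsets n ] (𝟙 (not t) * (sgn ∣ I ∣ * 𝟙 (I ⊆ᵇ L)))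
    ≡⟨ ≡.sym (*-distribˡ-∑ (𝟙 (not t)) (allSubsets n) _) ⟩
  𝟙 (not t) * ∑[ I ∈ allSubsets n ] (sgn ∣ I ∣ * 𝟙 (I ⊆ᵇ L))
    ≡⟨ cong (𝟙 (not t) *_) (inclusion-exclusion n L) ⟩
  𝟙 (not t) * 𝟙 (emptyᵇ L)
    ≡⟨ ≡.sym (𝟙-∧ (not t) (emptyᵇ L)) ⟩
  𝟙 (emptyᵇ (t ∷ L)) ∎
  where
  open ≡-Reasoning
  cancel : ∀ t s b → ℚ.- s * 𝟙 (t ∧ b) + (s * 𝟙 b + 0ℚ) ≡ 𝟙 (not t) * (s * 𝟙 b)
  cancel true  s b =
    solve 2 (λ s x → (:- s :* x) :+ ((s :* x) :+ con 0ℚ) := con 0ℚ :* (s :* x)) refl s (𝟙 b)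
  cancel false s b =
    solve 2 (λ s x → (:- s :* con 0ℚ) :+ ((s :* x) :+ con 0ℚ) := con 1ℚ :* (s :* x)) refl s (𝟙 b)

-- Arrangements

record Enumerates {n} (W : Subset n) (w : List (Fin n)) : Set where
  field
    unique   : Unique w
    sound    : ∀ {v} → v ∈ₗ w → lookup W v ≡ true
    complete : ∀ v → lookup W v ≡ true → v ∈ₗ w
open Enumerates

enumerates-∷⁺ : ∀ {n} {W : Subset n} {x w} → lookup W x ≡ true → Enumerates (W - x) w → Enumerates W (x ∷ w)
enumerates-∷⁺ {W = W} {x} x∈W e = record
  { unique   = All.tabulate (λ v∈w x≡v → x∉w (≡.subst (_∈ₗ _) (≡.sym x≡v) v∈w)) ∷ unique e
  ; sound    = λ { (here refl) → x∈W ; (there v∈w) → proj₁ (lookup-−⁻ W (sound e v∈w)) }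
  ; complete = λ v v∈W → case-on v v∈W
  }
  where
  x∉w : x ∉ₗ _
  x∉w x∈w = not-¬ (sound e x∈w) (lookup-−-self W x)
  case-on : ∀ v → lookup W v ≡ true → v ∈ₗ x ∷ _
  case-on v v∈W with v ≟ x
  ... | yes refl = here refl
  ... | no v≢x   = there (complete e v (trans (lookup-−-other W v≢x) v∈W))

enumerates-∷⁻ : ∀ {n} {W : Subset n} {x w} → Enumerates W (x ∷ w) → Enumerates (W - x) w
enumerates-∷⁻ {W = W} {x} e = record
  { unique   = tail (unique e)
  ; sound    = λ {v} v∈w → trans (lookup-−-other W (λ { refl → x∉w v∈w })) (sound e (there v∈w))
  ; complete = λ v v∈W-x → there-unless v (lookup-−⁻ W v∈W-x)
  }
  where
  tail : ∀ {w} → Unique (x ∷ w) → Unique w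
  tail (_ ∷ !w) = !w
  x∉w : x ∉ₗ _
  x∉w = Unique.Unique[x∷xs]⇒x∉xs (unique e)
  there-unless : ∀ v → lookup W v ≡ true × v ≢ x → v ∈ₗ _
  there-unless v (v∈W , v≢x) with complete e v v∈W
  ... | here v≡x  = ⊥-elim (v≢x v≡x)
  ... | there v∈w = v∈w

arrangements : ∀ {n} → ℕ → Subset n → List (List (Fin n))
arrangements zero    W = [] ∷ []
arrangements (suc k) W = concatMap (λ x → map (x ∷_) (arrangements k (W - x))) (filter (_∈? W) (allFin _))

∑-arrangements : ∀ {n} k (W : Subset n) (f : List (Fin n) → ℚ) →
  ∑ (arrangements (suc k) W) f ≡
  ∑[ x ∈ allFin n ] (𝟙 (lookup W x) * ∑[ w ∈ arrangements k (W - x) ] f (x ∷ w))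
∑-arrangements k W f =
  trans (∑-concatMap _ (filter (_∈? W) (allFin _)) f)
  (trans (∑-cong (filter (_∈? W) (allFin _)) (λ x → ∑-map (x ∷_) (arrangements k (W - x)) f))
         (∑-filter-∈? W _))

∈-arrangements⁻ : ∀ {n} k (W : Subset n) {w} → w ∈ₗ arrangements (suc k) W →
  ∃ λ x → ∃ λ ws → w ≡ x ∷ ws × lookup W x ≡ true × ws ∈ₗ arrangements k (W - x)
∈-arrangements⁻ k W w∈ with ∈-concatMap⁻ _ (filter (_∈? W) (allFin _)) w∈
... | x , x∈W , w∈x∷ with ∈-map⁻ (x ∷_) w∈x∷
...   | ws , ws∈ , refl = x , ws , refl , ∈-filter-∈?⁻ x∈W , ws∈

∈-arrangements⁺ : ∀ {n} k (W : Subset n) {x ws} → lookup W x ≡ true → ws ∈ₗ arrangements k (W - x) →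
                  (x ∷ ws) ∈ₗ arrangements (suc k) W
∈-arrangements⁺ k W {x} x∈W ws∈ =
  ∈-concatMap⁺ (λ y → map (y ∷_) (arrangements k (W - y))) (∈-filter-∈?⁺ {p = W} x∈W)
               (∈-map⁺ (x ∷_) ws∈)

arrangements⁻ : ∀ {n} k (W : Subset n) {w} → ∣ W ∣ ≡ k → w ∈ₗ arrangements k W → Enumerates W w
arrangements⁻ zero    W ∣W∣≡0 (here refl) = record
  { unique   = []
  ; sound    = λ ()
  ; complete = λ v v∈W → ⊥-elim (not-¬ v∈W (∣p∣≡0⇒lookup≡false W ∣W∣≡0 v))
  }
arrangements⁻ (suc k) W ∣W∣≡1+k w∈ with ∈-arrangements⁻ k W w∈
... | x , ws , refl , x∈W , ws∈ =
  enumerates-∷⁺ x∈W (arrangements⁻ k (W - x) (∣p-x∣≡k W x x∈W ∣W∣≡1+k) ws∈)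

arrangements⁺ : ∀ {n} k (W : Subset n) {w} → length w ≡ k → Enumerates W w → w ∈ₗ arrangements k W
arrangements⁺ zero    W {[]}     _      _ = here refl
arrangements⁺ (suc k) W {x ∷ ws} length e =
  ∈-arrangements⁺ k W (sound e (here refl))
    (arrangements⁺ k (W - x) (ℕ.suc-injective length) (enumerates-∷⁻ e))

length-arrangements : ∀ {n} k (W : Subset n) {w} → w ∈ₗ arrangements k W → length w ≡ k
length-arrangements zero    W (here refl) = refl
length-arrangements (suc k) W w∈ with ∈-arrangements⁻ k W w∈
... | x , ws , refl , _ , ws∈ = cong suc (length-arrangements k (W - x) ws∈)

arrangements-unique : ∀ {n} k (W : Subset n) → Unique (arrangements k W)
arrangements-unique zero    W = [] ∷ []
arrangements-unique (suc k) W =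
  Unique-concatMap _ (Unique.filter⁺ (_∈? W) (Unique.allFin⁺ _))
    (λ x → Unique.map⁺ Listₚ.∷-injectiveʳ (arrangements-unique k (W - x))) same-head
  where
  same-head : ∀ {x y z} → z ∈ₗ map (x ∷_) (arrangements k (W - x)) →
              z ∈ₗ map (y ∷_) (arrangements k (W - y)) → x ≡ y
  same-head {x} {y} z∈x z∈y with ∈-map⁻ (x ∷_) z∈x | ∈-map⁻ (y ∷_) z∈y
  ... | _ , _ , refl | _ , _ , refl = refl

position : ∀ {n} → List (Fin n) → Fin n → ℕ
position []      v = 0
position (y ∷ w) v = if does (v ≟ y) then 0 else suc (position w v)

position-here : ∀ {n} (y : Fin n) w → position (y ∷ w) y ≡ 0
position-here y w with y ≟ y
... | yes _   = refl
... | no y≢y = ⊥-elim (y≢y refl)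

position-there : ∀ {n} {y v : Fin n} w → v ≢ y → position (y ∷ w) v ≡ suc (position w v)
position-there {y = y} {v} w v≢y with v ≟ y
... | yes v≡y = ⊥-elim (v≢y v≡y)
... | no _    = refl

position-∷-≤ : ∀ {n} (y u : Fin n) w → position (y ∷ w) u ℕ.≤ suc (position w u)
position-∷-≤ y u w with does (u ≟ y)
... | true  = ℕ.z≤n
... | false = ℕ.≤-refl

position<length : ∀ {n} {v : Fin n} w → v ∈ₗ w → position w v ℕ.< length w
position<length {v = v} (y ∷ w) v∈ with v ≟ y | v∈
... | yes _   | _         = ℕ.s≤s ℕ.z≤n
... | no v≢y | here v≡y  = ⊥-elim (v≢y v≡y)
... | no _    | there v∈w = ℕ.s≤s (position<length w v∈w)

position-∉ : ∀ {n} {v : Fin n} w → v ∉ₗ w → position w v ≡ length w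
position-∉          []      _   = refl
position-∉ {v = v} (y ∷ w) v∉ with v ≟ y
... | yes v≡y = ⊥-elim (v∉ (here v≡y))
... | no _    = cong suc (position-∉ w (v∉ ∘ there))

position-injective : ∀ {n} {u v : Fin n} w → u ∈ₗ w → position w u ≡ position w v → u ≡ v
position-injective {u = u} {v} (y ∷ w) u∈ pos≡ with u ≟ y | v ≟ y | u∈
... | yes u≡y | yes v≡y | _         = trans u≡y (≡.sym v≡y)
... | no u≢y  | _       | here u≡y  = ⊥-elim (u≢y u≡y)
... | no _    | no _    | there u∈w = position-injective w u∈w (ℕ.suc-injective pos≡)
... | yes _   | no _    | _         = ⊥-elim (ℕ.0≢1+n pos≡)
... | no _    | yes _   | there _   = ⊥-elim (ℕ.0≢1+n (≡.sym pos≡))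

position-surjective : ∀ {n} (w : List (Fin n)) → Unique w → ∀ {i} → i ℕ.< length w →
                      ∃ λ v → v ∈ₗ w × position w v ≡ i
position-surjective (y ∷ w) _            {zero}  _ = y , here refl , position-here y w
position-surjective (y ∷ w) (y∉w ∷ !w) {suc i} (ℕ.s≤s i<∣w∣) with position-surjective w !w i<∣w∣
... | v , v∈w , pos≡i =
  v , there v∈w , trans (position-there w (λ { refl → All.lookup y∉w v∈w refl })) (cong suc pos≡i)

position-ext : ∀ {n} (w w′ : List (Fin n)) → Unique w → Unique w′ → length w ≡ length w′ →
               (∀ v → position w v ≡ position w′ v) → w ≡ w′
position-ext []      []        _            _              _     _    = refl
position-ext (x ∷ w) (y ∷ w′) (x∉w ∷ !w) (y∉w′ ∷ !w′) ∣w∣≡ same with x ≟ y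
... | no x≢y  = ⊥-elim (ℕ.0≢1+n (trans (≡.sym (position-here x w)) (trans (same x) (position-there w′ x≢y))))
... | yes refl = cong (x ∷_) (position-ext w w′ !w !w′ (ℕ.suc-injective ∣w∣≡) same-tail)
  where
  same-tail : ∀ v → position w v ≡ position w′ v
  same-tail v with v ≟ x
  ... | yes refl = trans (position-∉ w (λ x∈w → All.lookup x∉w x∈w refl))
                   (trans (ℕ.suc-injective ∣w∣≡)
                          (≡.sym (position-∉ w′ (λ x∈w′ → All.lookup y∉w′ x∈w′ refl))))
  ... | no v≢x   =
    ℕ.suc-injective (trans (≡.sym (position-there w v≢x)) (trans (same v) (position-there w′ v≢x)))

position-tabulate : ∀ {n k} (h : Fin k → Fin n) → (∀ {i j} → h i ≡ h j → i ≡ j) →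
                    ∀ i → position (List.tabulate h) (h i) ≡ toℕ i
position-tabulate h h-inj zero    = position-here (h zero) (List.tabulate (h ∘ suc))
position-tabulate h h-inj (suc i) =
  trans (position-there (List.tabulate (h ∘ suc)) (1+i≢0 ∘ h-inj))
        (cong suc (position-tabulate (h ∘ suc) (Fin.suc-injective ∘ h-inj) i))
  where
  1+i≢0 : suc i ≢ zero
  1+i≢0 ()

-- Reducing positions mod n only makes toOrdering total: on enumerations of all n vertices they
-- are already below n.
toOrdering : ∀ {m} → List (Fin (suc m)) → Ordering (suc m)
toOrdering {m} w = Vec.tabulate (λ v → position w v mod suc m)

toℕ-mod : ∀ {k} m → k ℕ.< suc m → toℕ (k mod suc m) ≡ k
toℕ-mod {k} m k<1+m = trans (Fin.toℕ-fromℕ< (ℕ.m%n<n k (suc m))) (ℕ.m<n⇒m%n≡m k<1+m)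

position<1+m : ∀ {m} {w : List (Fin (suc m))} {v} → length w ≡ suc m → v ∈ₗ w → position w v ℕ.< suc m
position<1+m {w = w} {v} ∣w∣≡ v∈w = ≡.subst (position w v ℕ.<_) ∣w∣≡ (position<length w v∈w)

toℕ-toOrdering : ∀ {m} {w : List (Fin (suc m))} {v} → length w ≡ suc m → v ∈ₗ w →
                 toℕ (lookup (toOrdering w) v) ≡ position w v
toℕ-toOrdering {m} {w} {v} ∣w∣≡ v∈w =
  trans (cong toℕ (Vecₚ.lookup∘tabulate (λ v → position w v mod suc m) v))
        (toℕ-mod m (position<1+m ∣w∣≡ v∈w))

toOrdering-bijective : ∀ {m} {w : List (Fin (suc m))} →
                       Enumerates ⊤ w → length w ≡ suc m → IsBijection (toOrdering w)
toOrdering-bijective {w = w} e ∣w∣≡ = injective , surjective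
  where
  in-w : ∀ v → v ∈ₗ w
  in-w v = complete e v (lookup-⊤ v)
  injective : ∀ u v → lookup (toOrdering w) u ≡ lookup (toOrdering w) v → u ≡ v
  injective u v π[u]≡π[v] = position-injective w (in-w u)
    (trans (≡.sym (toℕ-toOrdering ∣w∣≡ (in-w u)))
           (trans (cong toℕ π[u]≡π[v]) (toℕ-toOrdering ∣w∣≡ (in-w v))))
  surjective : ∀ k → ∃ λ v → lookup (toOrdering w) v ≡ k
  surjective k with position-surjective w (unique e) (≡.subst (toℕ k ℕ.<_) (≡.sym ∣w∣≡) (Fin.toℕ<n k))
  ... | v , v∈w , pos≡k = v , Fin.toℕ-injective (trans (toℕ-toOrdering ∣w∣≡ v∈w) pos≡k)

toOrdering-injective : ∀ {m} {w w′ : List (Fin (suc m))} →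
  Enumerates ⊤ w → length w ≡ suc m → Enumerates ⊤ w′ → length w′ ≡ suc m →
  toOrdering w ≡ toOrdering w′ → w ≡ w′
toOrdering-injective {w = w} {w′} e ∣w∣≡ e′ ∣w′∣≡ π≡π′ =
  position-ext w w′ (unique e) (unique e′) (trans ∣w∣≡ (≡.sym ∣w′∣≡)) λ v →
    trans (≡.sym (toℕ-toOrdering ∣w∣≡ (complete e v (lookup-⊤ v))))
          (trans (cong (λ π → toℕ (lookup π v)) π≡π′)
                 (toℕ-toOrdering ∣w′∣≡ (complete e′ v (lookup-⊤ v))))

toOrdering-surjective : ∀ {m} (π : Ordering (suc m)) → IsBijection π →
                        ∃ λ w → w ∈ₗ arrangements (suc m) ⊤ × toOrdering w ≡ π
toOrdering-surjective {m} π (π-injective , π-surjective) = w , w∈ , toOrdering-w≡π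
  where
  π⁻¹ : Fin (suc m) → Fin (suc m)
  π⁻¹ k = proj₁ (π-surjective k)
  π∘π⁻¹ : ∀ k → lookup π (π⁻¹ k) ≡ k
  π∘π⁻¹ k = proj₂ (π-surjective k)
  π⁻¹∘π : ∀ v → π⁻¹ (lookup π v) ≡ v
  π⁻¹∘π v = π-injective _ _ (π∘π⁻¹ (lookup π v))
  π⁻¹-injective : ∀ {i j} → π⁻¹ i ≡ π⁻¹ j → i ≡ j
  π⁻¹-injective {i} {j} e = trans (≡.sym (π∘π⁻¹ i)) (trans (cong (lookup π) e) (π∘π⁻¹ j))
  w : List (Fin (suc m))
  w = List.tabulate π⁻¹
  ∣w∣≡ : length w ≡ suc m
  ∣w∣≡ = Listₚ.length-tabulate π⁻¹
  position≡π : ∀ v → position w v ≡ toℕ (lookup π v)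
  position≡π v = trans (cong (position w) (≡.sym (π⁻¹∘π v)))
                       (position-tabulate π⁻¹ π⁻¹-injective (lookup π v))
  e : Enumerates ⊤ w
  e = record
    { unique   = Unique.tabulate⁺ π⁻¹-injective
    ; sound    = λ {v} _ → lookup-⊤ v
    ; complete = λ v _ → ≡.subst (_∈ₗ w) (π⁻¹∘π v) (∈-tabulate⁺ {f = π⁻¹} (lookup π v))
    }
  w∈ : w ∈ₗ arrangements (suc m) ⊤
  w∈ = arrangements⁺ (suc m) ⊤ ∣w∣≡ e
  toOrdering-w≡π : toOrdering w ≡ π
  toOrdering-w≡π = trans (Vecₚ.tabulate-cong {f = λ v → position w v mod suc m} {g = lookup π} λ v →
      Fin.toℕ-injective
      (trans (toℕ-mod m (position<1+m ∣w∣≡ (complete e v (lookup-⊤ v)))) (position≡π v)))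
    (Vecₚ.tabulate∘lookup π)

allVecs-unique : ∀ n k → Unique (allVecs n k)
allVecs-unique n zero    = [] ∷ []
allVecs-unique n (suc k) =
  Unique-concatMap (λ x → map (x ∷_) (allVecs n k)) (Unique.allFin⁺ n)
    (λ x → Unique.map⁺ Vecₚ.∷-injectiveʳ (allVecs-unique n k)) same-head
  where
  same-head : ∀ {x y z} → z ∈ₗ map (x ∷_) (allVecs n k) → z ∈ₗ map (y ∷_) (allVecs n k) → x ≡ y
  same-head {x} {y} z∈x z∈y with ∈-map⁻ (x ∷_) z∈x | ∈-map⁻ (y ∷_) z∈y
  ... | _ , _ , refl | _ , _ , refl = refl

∈-allVecs : ∀ n k (v : Vec (Fin n) k) → v ∈ₗ allVecs n k
∈-allVecs n zero    []      = here refl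
∈-allVecs n (suc k) (x ∷ v) =
  ∈-concatMap⁺ (λ y → map (y ∷_) (allVecs n k)) (∈-allFin x) (∈-map⁺ (x ∷_) (∈-allVecs n k v))

-- Neighbourhoods, lonely vertices and the counting lemma

module _ {n} (G : Graph n) where

  lookup-N : ∀ S v → lookup (N G S) v ≡ does (any? (λ u → (u ∈? S) ×-dec Adj? G u v))
  lookup-N S v = trans (Vecₚ.lookup∘tabulate _ v) (fromDec≡does (any? (λ u → (u ∈? S) ×-dec Adj? G u v)))

  lookup-N⁺ : ∀ {S u v} → lookup S u ≡ true → Adj G u v → lookup (N G S) v ≡ true
  lookup-N⁺ {S} {u} {v} u∈S u~v =
    trans (lookup-N S v)
          (dec-true (any? (λ u → (u ∈? S) ×-dec Adj? G u v)) (u , Vecₚ.lookup⇒[]= u S u∈S , u~v))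

  lookup-N⁻ : ∀ {S v} → lookup (N G S) v ≡ true → ∃ λ u → lookup S u ≡ true × Adj G u v
  lookup-N⁻ {S} {v} v∈NS
    with does-true⁻ (any? (λ u → (u ∈? S) ×-dec Adj? G u v)) (trans (≡.sym (lookup-N S v)) v∈NS)
  ... | u , u∈S , u~v = u , Vecₚ.[]=⇒lookup u∈S , u~v

  N-mono : ∀ S T → S ⊆ T → N G S ⊆ N G T
  N-mono S T S⊆T v v∈NS with lookup-N⁻ v∈NS
  ... | u , u∈S , u~v = lookup-N⁺ (S⊆T u u∈S) u~v

  ∉N⇒¬adj : ∀ {S u v} → lookup S u ≡ true → lookup (N G S) v ≡ false → adj G u v ≡ false
  ∉N⇒¬adj u∈S v∉NS = ¬-not (λ u~v → not-¬ (lookup-N⁺ u∈S u~v) v∉NS)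

  lookup-N-∪⁅⁆⁻ : ∀ {S y v} →
                  lookup (N G (S ∪ ⁅ y ⁆)) v ≡ true → lookup (N G S) v ≡ true ⊎ Adj G y v
  lookup-N-∪⁅⁆⁻ {S} v∈N with lookup-N⁻ v∈N
  ... | u , u∈S∪y , u~v with lookup-∪⁅⁆⁻ S u∈S∪y
  ...   | inj₁ u∈S = inj₁ (lookup-N⁺ u∈S u~v)
  ...   | inj₂ refl = inj₂ u~v

  I⊆N[I] : ∀ I → I ⊆ N[ G , I ]
  I⊆N[I] I = p⊆p∪q I (N G I)

  N[I]⊆W⇒I⊆W : ∀ I W → N[ G , I ] ⊆ W → I ⊆ W
  N[I]⊆W⇒I⊆W I W N[I]⊆W = ⊆-trans I N[ G , I ] W (I⊆N[I] I) N[I]⊆W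

  N[]-mono : ∀ J I → J ⊆ I → N[ G , J ] ⊆ N[ G , I ]
  N[]-mono J I J⊆I v v∈N[J] with ∨-true⁻ (trans (≡.sym (lookup-∪ J (N G J) v)) v∈N[J])
  ... | inj₁ v∈J  = p⊆p∪q I (N G I) v (J⊆I v v∈J)
  ... | inj₂ v∈NJ = q⊆p∪q I (N G I) v (N-mono J I J⊆I v v∈NJ)

  independent⇒¬adj : ∀ {I u v} → Independent G I →
                     lookup I u ≡ true → lookup I v ≡ true → adj G u v ≡ false
  independent⇒¬adj {I} {u} {v} indep u∈I v∈I =
    ¬-not (indep u v (Vecₚ.lookup⇒[]= u I u∈I) (Vecₚ.lookup⇒[]= v I v∈I))

  independent-⊆ : ∀ {I J} → J ⊆ I → Independent G I → Independent G J
  independent-⊆ {I} J⊆I indep u v u∈J v∈J =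
    indep u v (Vecₚ.lookup⇒[]= u I (J⊆I u (Vecₚ.[]=⇒lookup u∈J)))
              (Vecₚ.lookup⇒[]= v I (J⊆I v (Vecₚ.[]=⇒lookup v∈J)))

  x∉N[I-x] : ∀ I x → Independent G I → lookup I x ≡ true → lookup N[ G , I - x ] x ≡ false
  x∉N[I-x] I x indep x∈I =
    trans (lookup-∪ (I - x) (N G (I - x)) x) (cong₂ _∨_ (lookup-−-self I x) x∉N⟨I-x⟩)
    where
    x∉N⟨I-x⟩ : lookup (N G (I - x)) x ≡ false
    x∉N⟨I-x⟩ = ¬-not λ x∈N → let (u , u∈I-x , u~x) = lookup-N⁻ x∈N in
      not-¬ u~x (independent⇒¬adj indep (p-x⊆p I x u u∈I-x) x∈I)

  n∸a≡∣N[I]∣ : ∀ I → n ∸ a G I ≡ ∣ N[ G , I ] ∣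
  n∸a≡∣N[I]∣ I =
    trans (cong (n ∸_) (Subset.∣∁p∣≡n∸∣p∣ N[ G , I ])) (ℕ.m∸[m∸n]≡n (Subset.∣p∣≤n N[ G , I ]))

  b-recurrence : ∀ I →
    ∑[ x ∈ allFin n ] (𝟙 (lookup I x) * b G (I - x)) ≡ ℕtoℚ ∣ N[ G , I ] ∣ * b G I
  b-recurrence I with ∣ I ∣ in ∣I∣≡
  ... | zero = begin
    ∑[ x ∈ allFin n ] (𝟙 (lookup I x) * b G (I - x))
      ≡⟨ ∑-cong (allFin n) (λ x → cong (λ t → 𝟙 t * b G (I - x)) (I-empty x)) ⟩
    ∑[ x ∈ allFin n ] (0ℚ * b G (I - x))
      ≡⟨ ∑-cong (allFin n) (λ x → ℚ.*-zeroˡ (b G (I - x))) ⟩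
    ∑[ x ∈ allFin n ] 0ℚ
      ≡⟨ ∑-0 (allFin n) ⟩
    0ℚ
      ≡⟨ cong (λ k → ℕtoℚ k * 1ℚ) (≡.sym (lookup≡false⇒∣p∣≡0 N[ G , I ] N[I]-empty)) ⟩
    ℕtoℚ ∣ N[ G , I ] ∣ * 1ℚ ∎
    where
    open ≡-Reasoning
    I-empty : ∀ v → lookup I v ≡ false
    I-empty = ∣p∣≡0⇒lookup≡false I ∣I∣≡
    N[I]-empty : ∀ v → lookup N[ G , I ] v ≡ false
    N[I]-empty v = trans (lookup-∪ I (N G I) v) (cong₂ _∨_ (I-empty v)
      (¬-not λ v∈NI → let (u , u∈I , _) = lookup-N⁻ v∈NI in not-¬ u∈I (I-empty u)))
  ... | suc j = begin
    ∑[ x ∈ allFin n ] (𝟙 (lookup I x) * bAux G ∣ I - x ∣ (I - x))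
      ≡⟨ ∑-cong (allFin n) shrink ⟩
    ∑[ x ∈ allFin n ] (𝟙 (lookup I x) * bAux G j (I - x))
      ≡⟨ ≡.sym (∑-filter-∈? I (λ x → bAux G j (I - x))) ⟩
    ∑[ x ∈ filter (_∈? I) (allFin n) ] bAux G j (I - x)
      ≡⟨ ≡.sym (inv-cancel ∣ N[ G , I ] ∣ Σb 0<∣N[I]∣) ⟩
    ℕtoℚ ∣ N[ G , I ] ∣ * (inv ∣ N[ G , I ] ∣ * Σb)
      ≡⟨ cong (λ k → ℕtoℚ ∣ N[ G , I ] ∣ * (inv k * Σb)) (≡.sym (n∸a≡∣N[I]∣ I)) ⟩
    ℕtoℚ ∣ N[ G , I ] ∣ * (inv (n ∸ a G I) * Σb) ∎
    where
    open ≡-Reasoning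
    Σb : ℚ
    Σb = ∑[ x ∈ filter (_∈? I) (allFin n) ] bAux G j (I - x)
    shrink : ∀ x → 𝟙 (lookup I x) * bAux G ∣ I - x ∣ (I - x) ≡ 𝟙 (lookup I x) * bAux G j (I - x)
    shrink x with lookup I x in x∈I
    ... | true  = cong (λ k → 1ℚ * bAux G k (I - x)) (∣p-x∣≡k I x x∈I ∣I∣≡)
    ... | false = trans (ℚ.*-zeroˡ (bAux G ∣ I - x ∣ (I - x))) (≡.sym (ℚ.*-zeroˡ (bAux G j (I - x))))
    0<∣N[I]∣ : 0 ℕ.< ∣ N[ G , I ] ∣
    0<∣N[I]∣ = ℕ.≤-trans (ℕ.s≤s ℕ.z≤n)
      (≡.subst (ℕ._≤ ∣ N[ G , I ] ∣) ∣I∣≡ (Subset.p⊆q⇒∣p∣≤∣q∣ (Subset.p⊆p∪q {p = I} (N G I))))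

  -- S is the set of vertices placed before w.  A vertex of w is lonely if none of its neighbours
  -- lies in S or precedes it in w.
  successiveAfter : Subset n → List (Fin n) → Bool
  successiveAfter S []      = true
  successiveAfter S (y ∷ w) = lookup (N G S) y ∧ successiveAfter (S ∪ ⁅ y ⁆) w

  HasEarlierNeighbour : Subset n → List (Fin n) → Fin n → Set
  HasEarlierNeighbour S w v = lookup (N G S) v ≡ true ⊎ ∃ λ u → Adj G u v × position w u ℕ.< position w v

  successiveAfter⁻ : ∀ S w → successiveAfter S w ≡ true → ∀ {v} → v ∈ₗ w → HasEarlierNeighbour S w v
  successiveAfter⁻ S (y ∷ w) successive {v} v∈y∷w with v ≟ y | v∈y∷w
  ... | yes refl | _          = inj₁ (∧-conicalˡ _ _ successive)
  ... | no v≢y   | here v≡y   = ⊥-elim (v≢y v≡y)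
  ... | no _     | there v∈w with successiveAfter⁻ (S ∪ ⁅ y ⁆) w (∧-conicalʳ _ _ successive) v∈w
  ...   | inj₂ (u , u~v , u<v) = inj₂ (u , u~v , ℕ.≤-<-trans (position-∷-≤ y u w) (ℕ.s≤s u<v))
  ...   | inj₁ v∈N with lookup-N-∪⁅⁆⁻ v∈N
  ...     | inj₁ v∈NS = inj₁ v∈NS
  ...     | inj₂ y~v  =
    inj₂ (y , y~v , ≡.subst (ℕ._< suc (position w v)) (≡.sym (position-here y w)) (ℕ.s≤s ℕ.z≤n))

  successiveAfter⁺ : ∀ S w → Unique w → (∀ {v} → v ∈ₗ w → HasEarlierNeighbour S w v) →
                     successiveAfter S w ≡ true
  successiveAfter⁺ S []      _            _       = refl
  successiveAfter⁺ S (y ∷ w) (y∉w ∷ !w) earlier = cong₂ _∧_ head (successiveAfter⁺ (S ∪ ⁅ y ⁆) w !w tail)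
    where
    head : lookup (N G S) y ≡ true
    head with earlier (here refl)
    ... | inj₁ y∈NS            = y∈NS
    ... | inj₂ (u , _ , u<y) = ⊥-elim (ℕ.n≮0 (≡.subst (position (y ∷ w) u ℕ.<_) (position-here y w) u<y))
    tail : ∀ {v} → v ∈ₗ w → HasEarlierNeighbour (S ∪ ⁅ y ⁆) w v
    tail {v} v∈w with earlier (there v∈w)
    ... | inj₁ v∈NS = inj₁ (N-mono S (S ∪ ⁅ y ⁆) (p⊆p∪q S ⁅ y ⁆) v v∈NS)
    ... | inj₂ (u , u~v , u<v) with u ≟ y
    ...   | yes refl = inj₁ (lookup-N⁺ (x∈p∪⁅x⁆ S u) u~v)
    ...   | no u≢y   =
      inj₂ (u , u~v , ℕ.≤-pred (≡.subst (suc (position w u) ℕ.<_) (position-there w v≢y) u<v))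
      where
      v≢y : v ≢ y
      v≢y refl = All.lookup y∉w v∈w refl

  lonely : Subset n → List (Fin n) → Fin n → Bool
  lonely S []      v = false
  lonely S (y ∷ w) v = if does (v ≟ y) then not (lookup (N G S) y) else lonely (S ∪ ⁅ y ⁆) w v

  allLonely : Subset n → Subset n → List (Fin n) → Bool
  allLonely S I []      = true
  allLonely S I (y ∷ w) = not (lookup I y ∧ lookup (N G S) y) ∧ allLonely (S ∪ ⁅ y ⁆) I w

  lonely-here : ∀ S y w → lonely S (y ∷ w) y ≡ not (lookup (N G S) y)
  lonely-here S y w with y ≟ y
  ... | yes _   = refl
  ... | no y≢y = ⊥-elim (y≢y refl)

  lonely-there : ∀ S {y} w {v} → v ≢ y → lonely S (y ∷ w) v ≡ lonely (S ∪ ⁅ y ⁆) w v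
  lonely-there S {y} w {v} v≢y with v ≟ y
  ... | yes v≡y = ⊥-elim (v≢y v≡y)
  ... | no _    = refl

  lonely⇒∈ : ∀ S w {v} → lonely S w v ≡ true → v ∈ₗ w
  lonely⇒∈ S (y ∷ w) {v} lonely-v with v ≟ y
  ... | yes refl = here refl
  ... | no _     = there (lonely⇒∈ (S ∪ ⁅ y ⁆) w lonely-v)

  lonely⇒∉N : ∀ S w {v} → lonely S w v ≡ true → lookup (N G S) v ≡ false
  lonely⇒∉N S (y ∷ w) {v} lonely-v with v ≟ y
  ... | yes refl = not-injective lonely-v
  ... | no _     =
    ⊆-lookup-false (N G S) (N G (S ∪ ⁅ y ⁆)) (N-mono S (S ∪ ⁅ y ⁆) (p⊆p∪q S ⁅ y ⁆)) v
                   (lonely⇒∉N (S ∪ ⁅ y ⁆) w lonely-v)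

  lonely-independent : ∀ S w {u v} → lonely S w u ≡ true → lonely S w v ≡ true → adj G u v ≡ false
  lonely-independent S (y ∷ w) {u} {v} lonely-u lonely-v with u ≟ y | v ≟ y
  ... | yes refl | yes refl = irrefl G u
  ... | yes refl | no _     = ∉N⇒¬adj (x∈p∪⁅x⁆ S u) (lonely⇒∉N (S ∪ ⁅ u ⁆) w lonely-v)
  ... | no _     | yes refl =
    trans (sym G u v) (∉N⇒¬adj (x∈p∪⁅x⁆ S v) (lonely⇒∉N (S ∪ ⁅ v ⁆) w lonely-u))
  ... | no _     | no _     = lonely-independent (S ∪ ⁅ y ⁆) w lonely-u lonely-v

  allLonely⇒lonely : ∀ S I {w} → Unique w → allLonely S I w ≡ true →
                     ∀ {v} → lookup I v ≡ true → v ∈ₗ w → lonely S w v ≡ true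
  allLonely⇒lonely S I {y ∷ w} (y∉w ∷ !w) all-lonely {v} v∈I v∈y∷w with v ≟ y | v∈y∷w
  ... | yes refl | _          =
    ≡.subst (λ b → not (b ∧ lookup (N G S) v) ≡ true) v∈I (∧-conicalˡ _ _ all-lonely)
  ... | no v≢y   | here v≡y   = ⊥-elim (v≢y v≡y)
  ... | no _     | there v∈w  = allLonely⇒lonely (S ∪ ⁅ y ⁆) I !w (∧-conicalʳ _ _ all-lonely) v∈I v∈w

  lonely⇒allLonely : ∀ S I {w} → Unique w →
                     (∀ {v} → lookup I v ≡ true → v ∈ₗ w → lonely S w v ≡ true) → allLonely S I w ≡ true
  lonely⇒allLonely S I {[]}    _            _        = refl
  lonely⇒allLonely S I {y ∷ w} (y∉w ∷ !w) I-lonely =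
    cong₂ _∧_ head (lonely⇒allLonely (S ∪ ⁅ y ⁆) I !w tail)
    where
    head : not (lookup I y ∧ lookup (N G S) y) ≡ true
    head with lookup I y in y∈I
    ... | false = refl
    ... | true  = trans (≡.sym (lonely-here S y w)) (I-lonely y∈I (here refl))
    tail : ∀ {v} → lookup I v ≡ true → v ∈ₗ w → lonely (S ∪ ⁅ y ⁆) w v ≡ true
    tail v∈I v∈w =
      trans (≡.sym (lonely-there S w (λ { refl → All.lookup y∉w v∈w refl }))) (I-lonely v∈I (there v∈w))

  successiveAfter⇒¬lonely : ∀ S w → successiveAfter S w ≡ true → ∀ v → lonely S w v ≡ false
  successiveAfter⇒¬lonely S []      _          v = refl
  successiveAfter⇒¬lonely S (y ∷ w) successive v with v ≟ y
  ... | yes refl = cong not (∧-conicalˡ _ _ successive)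
  ... | no _     = successiveAfter⇒¬lonely (S ∪ ⁅ y ⁆) w (∧-conicalʳ _ _ successive) v

  ¬lonely⇒successiveAfter : ∀ S {w} → Unique w →
                            (∀ v → lonely S w v ≡ false) → successiveAfter S w ≡ true
  ¬lonely⇒successiveAfter S {[]}    _            _         = refl
  ¬lonely⇒successiveAfter S {y ∷ w} (y∉w ∷ !w) ¬lonely =
    cong₂ _∧_ (not-injective (trans (≡.sym (lonely-here S y w)) (¬lonely y)))
              (¬lonely⇒successiveAfter (S ∪ ⁅ y ⁆) !w tail)
    where
    tail : ∀ v → lonely (S ∪ ⁅ y ⁆) w v ≡ false
    tail v with v ≟ y
    ... | yes refl = ¬-not (λ lonely-y → All.lookup y∉w (lonely⇒∈ (S ∪ ⁅ y ⁆) w lonely-y) refl)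
    ... | no v≢y   = trans (≡.sym (lonely-there S w v≢y)) (¬lonely v)

  lonelySet : Subset n → List (Fin n) → Subset n
  lonelySet S w = Vec.tabulate (lonely S w)

  successiveAfter≡emptyᵇ : ∀ S {w} → Unique w → successiveAfter S w ≡ emptyᵇ (lonelySet S w)
  successiveAfter≡emptyᵇ S {w} !w = ≡-by-truth
    (λ successive → emptyᵇ-complete (lonelySet S w) (λ v →
       trans (Vecₚ.lookup∘tabulate (lonely S w) v) (successiveAfter⇒¬lonely S w successive v)))
    (λ empty → ¬lonely⇒successiveAfter S !w (λ v →
       trans (≡.sym (Vecₚ.lookup∘tabulate (lonely S w) v)) (emptyᵇ-sound (lonelySet S w) empty v)))

  ⊆ᵇ-lonelySet⇒lonely : ∀ S I w → I ⊆ᵇ lonelySet S w ≡ true →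
                        ∀ v → lookup I v ≡ true → lonely S w v ≡ true
  ⊆ᵇ-lonelySet⇒lonely S I w I⊆L v v∈I =
    trans (≡.sym (Vecₚ.lookup∘tabulate (lonely S w) v)) (⊆ᵇ-sound I (lonelySet S w) I⊆L v v∈I)

  ⊆ᵇ-lonelySet⇒independent : ∀ S I w → I ⊆ᵇ lonelySet S w ≡ true → Independent G I
  ⊆ᵇ-lonelySet⇒independent S I w I⊆L u v u∈I v∈I u~v = not-¬ u~v
    (lonely-independent S w (lonely-of u (Vecₚ.[]=⇒lookup u∈I)) (lonely-of v (Vecₚ.[]=⇒lookup v∈I)))
    where
    lonely-of : ∀ v → lookup I v ≡ true → lonely S w v ≡ true
    lonely-of = ⊆ᵇ-lonelySet⇒lonely S I w I⊆L

  ⊆ᵇ-lonelySet : ∀ S I {W w} → Enumerates W w →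
                 I ⊆ᵇ lonelySet S w ≡ does (Independent? G I) ∧ (I ⊆ᵇ W ∧ allLonely S I w)
  ⊆ᵇ-lonelySet S I {W} {w} e = ≡-by-truth
    (λ I⊆L → let lonely-of = ⊆ᵇ-lonelySet⇒lonely S I w I⊆L in
      cong₂ _∧_ (dec-true (Independent? G I) (⊆ᵇ-lonelySet⇒independent S I w I⊆L))
        (cong₂ _∧_ (⊆ᵇ-complete I W (λ v v∈I → sound e (lonely⇒∈ S w (lonely-of v v∈I))))
                   (lonely⇒allLonely S I (unique e) (λ {v} v∈I _ → lonely-of v v∈I))))
    (λ h → let h′ = ∧-conicalʳ (does (Independent? G I)) _ h in
      ⊆ᵇ-complete I (lonelySet S w) (λ v v∈I →
        trans (Vecₚ.lookup∘tabulate (lonely S w) v)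
              (allLonely⇒lonely S I (unique e) (∧-conicalʳ _ _ h′) v∈I
                 (complete e v (⊆ᵇ-sound I W (∧-conicalˡ _ _ h′) v v∈I)))))

  𝟙-successiveAfter : ∀ S {W w} → Enumerates W w →
    𝟙 (successiveAfter S w) ≡
    ∑[ I ∈ allSubsets n ] (sgn ∣ I ∣ * (𝟙 (does (Independent? G I)) * (𝟙 (I ⊆ᵇ W) * 𝟙 (allLonely S I w))))
  𝟙-successiveAfter S {W} {w} e = begin
    𝟙 (successiveAfter S w)
      ≡⟨ cong 𝟙 (successiveAfter≡emptyᵇ S (unique e)) ⟩
    𝟙 (emptyᵇ (lonelySet S w))
      ≡⟨ ≡.sym (inclusion-exclusion n (lonelySet S w)) ⟩
    ∑[ I ∈ allSubsets n ] (sgn ∣ I ∣ * 𝟙 (I ⊆ᵇ lonelySet S w))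
      ≡⟨ ∑-cong (allSubsets n) (λ I → cong (sgn ∣ I ∣ *_) (split I)) ⟩
    ∑[ I ∈ allSubsets n ] (sgn ∣ I ∣ * (𝟙 (does (Independent? G I)) * (𝟙 (I ⊆ᵇ W) * 𝟙 (allLonely S I w)))) ∎
    where
    open ≡-Reasoning
    split : ∀ I → 𝟙 (I ⊆ᵇ lonelySet S w) ≡
                  𝟙 (does (Independent? G I)) * (𝟙 (I ⊆ᵇ W) * 𝟙 (allLonely S I w))
    split I = trans (cong 𝟙 (⊆ᵇ-lonelySet S I e))
      (trans (𝟙-∧ (does (Independent? G I)) _) (cong (𝟙 (does (Independent? G I)) *_) (𝟙-∧ (I ⊆ᵇ W) _)))

  count : ℕ → Subset n → Subset n → ℚ
  count k W I = ∑[ w ∈ arrangements k W ] 𝟙 (allLonely (∁ W) I w)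

  ∑-successiveAfter : ∀ k W → ∣ W ∣ ≡ k →
    ∑[ w ∈ arrangements k W ] 𝟙 (successiveAfter (∁ W) w) ≡
    ∑[ I ∈ allSubsets n ] (sgn ∣ I ∣ * (𝟙 (does (Independent? G I)) * (𝟙 (I ⊆ᵇ W) * count k W I)))
  ∑-successiveAfter k W ∣W∣≡k = begin
    ∑[ w ∈ arrangements k W ] 𝟙 (successiveAfter (∁ W) w)
      ≡⟨ ∑-cong-∈ (arrangements k W) (λ w∈ → 𝟙-successiveAfter (∁ W) (arrangements⁻ k W ∣W∣≡k w∈)) ⟩
    ∑[ w ∈ arrangements k W ] ∑[ I ∈ allSubsets n ] (s I * (d I * (c I * 𝟙 (allLonely (∁ W) I w))))
      ≡⟨ ∑-comm (arrangements k W) (allSubsets n) _ ⟩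
    ∑[ I ∈ allSubsets n ] ∑[ w ∈ arrangements k W ] (s I * (d I * (c I * 𝟙 (allLonely (∁ W) I w))))
      ≡⟨ ∑-cong (allSubsets n) pull-out ⟩
    ∑[ I ∈ allSubsets n ] (s I * (d I * (c I * count k W I))) ∎
    where
    open ≡-Reasoning
    s d c : Subset n → ℚ
    s I = sgn ∣ I ∣
    d I = 𝟙 (does (Independent? G I))
    c I = 𝟙 (I ⊆ᵇ W)
    pull-out : ∀ I → ∑[ w ∈ arrangements k W ] (s I * (d I * (c I * 𝟙 (allLonely (∁ W) I w)))) ≡
                     s I * (d I * (c I * count k W I))
    pull-out I = begin
      ∑[ w ∈ arrangements k W ] (s I * (d I * (c I * 𝟙 (allLonely (∁ W) I w))))
        ≡⟨ ≡.sym (*-distribˡ-∑ (s I) (arrangements k W) _) ⟩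
      s I * ∑[ w ∈ arrangements k W ] (d I * (c I * 𝟙 (allLonely (∁ W) I w)))
        ≡⟨ cong (s I *_) (≡.sym (*-distribˡ-∑ (d I) (arrangements k W) _)) ⟩
      s I * (d I * ∑[ w ∈ arrangements k W ] (c I * 𝟙 (allLonely (∁ W) I w)))
        ≡⟨ cong (λ t → s I * (d I * t)) (≡.sym (*-distribˡ-∑ (c I) (arrangements k W) _)) ⟩
      s I * (d I * (c I * count k W I)) ∎

  no-neighbour-outside : ∀ W I {x} → N[ G , I ] ⊆ W → lookup I x ≡ true → lookup (N G (∁ W)) x ≡ false
  no-neighbour-outside W I {x} N[I]⊆W x∈I = ¬-not λ x∈N∁W → let (u , u∈∁W , u~x) = lookup-N⁻ x∈N∁W in
    not-¬ (N[I]⊆W u (q⊆p∪q I (N G I) u (lookup-N⁺ x∈I (trans (sym G x u) u~x))))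
          (not-injective (trans (≡.sym (lookup-∁ W u)) u∈∁W))

  allLonely-∷ : ∀ W I x w → N[ G , I ] ⊆ W → allLonely (∁ W) I (x ∷ w) ≡ allLonely (∁ (W - x)) I w
  allLonely-∷ W I x w N[I]⊆W = cong₂ _∧_ head (cong (λ S → allLonely S I w) (≡.sym (∁-─ W ⁅ x ⁆)))
    where
    head : not (lookup I x ∧ lookup (N G (∁ W)) x) ≡ true
    head with lookup I x in x∈I
    ... | false = refl
    ... | true  = cong not (no-neighbour-outside W I N[I]⊆W x∈I)

  allLonely-cong : ∀ S I J w → (∀ {v} → v ∈ₗ w → lookup I v ≡ lookup J v) →
                   allLonely S I w ≡ allLonely S J w
  allLonely-cong S I J []      _     = refl
  allLonely-cong S I J (y ∷ w) agree =
    cong₂ _∧_ (cong (λ b → not (b ∧ lookup (N G S) y)) (agree (here refl)))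
              (allLonely-cong (S ∪ ⁅ y ⁆) I J w (agree ∘ there))

  allLonely-false : ∀ S I {w u} → Unique w → lookup I u ≡ true → u ∈ₗ w → lookup (N G S) u ≡ true →
                    allLonely S I w ≡ false
  allLonely-false S I {w} !w u∈I u∈w u∈NS =
    ¬-not λ all-lonely → not-¬ u∈NS (lonely⇒∉N S w (allLonely⇒lonely S I !w all-lonely u∈I u∈w))

  count-suc : ∀ k W I → N[ G , I ] ⊆ W →
              count (suc k) W I ≡ ∑[ x ∈ allFin n ] (𝟙 (lookup W x) * count k (W - x) I)
  count-suc k W I N[I]⊆W = trans (∑-arrangements k W _) (∑-cong (allFin n) λ x →
    cong (𝟙 (lookup W x) *_) (∑-cong (arrangements k (W - x)) λ w → cong 𝟙 (allLonely-∷ W I x w N[I]⊆W)))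

  count-restrict : ∀ k W I x → ∣ W - x ∣ ≡ k → count k (W - x) I ≡ count k (W - x) (I - x)
  count-restrict k W I x ∣W-x∣≡k = ∑-cong-∈ (arrangements k (W - x)) λ w∈ →
    cong 𝟙 (allLonely-cong _ I (I - x) _ λ v∈w →
      ≡.sym (lookup-−-other I (proj₂ (lookup-−⁻ W (sound (arrangements⁻ k (W - x) ∣W-x∣≡k w∈) v∈w)))))

  count-blocked : ∀ k W I x → ∣ W - x ∣ ≡ k → N[ G , I ] ⊆ W → lookup I x ≡ false → lookup (N G I) x ≡ true →
                  count k (W - x) I ≡ 0ℚ
  count-blocked k W I x ∣W-x∣≡k N[I]⊆W x∉I x∈NI with lookup-N⁻ x∈NI
  ... | u , u∈I , u~x = trans (∑-cong-∈ (arrangements k (W - x)) blocked) (∑-0 (arrangements k (W - x)))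
    where
    u∈W-x : lookup (W - x) u ≡ true
    u∈W-x = trans (lookup-−-other W (λ { refl → not-¬ u∈I x∉I })) (N[I]⊆W u (I⊆N[I] I u u∈I))
    blocked : ∀ {w} → w ∈ₗ arrangements k (W - x) → 𝟙 (allLonely (∁ (W - x)) I w) ≡ 0ℚ
    blocked w∈ = let e = arrangements⁻ k (W - x) ∣W-x∣≡k w∈ in
      cong 𝟙 (allLonely-false (∁ (W - x)) I (unique e) u∈I (complete e u u∈W-x)
                (lookup-N⁺ (trans (lookup-∁ (W - x) x) (cong not (lookup-−-self W x))) (trans (sym G x u) u~x)))

  ∑-first-choice : ∀ W I → N[ G , I ] ⊆ W →
    ∑[ x ∈ allFin n ] (𝟙 (lookup I x) * b G (I - x) + 𝟙 (lookup (W ─ N[ G , I ]) x) * b G I) ≡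
    ℕtoℚ ∣ W ∣ * b G I
  ∑-first-choice W I N[I]⊆W = begin
    ∑[ x ∈ allFin n ] (𝟙 (lookup I x) * b G (I - x) + 𝟙 (lookup (W ─ N[ G , I ]) x) * b G I)
      ≡⟨ ∑-distrib-+ (allFin n) _ _ ⟩
    ∑[ x ∈ allFin n ] (𝟙 (lookup I x) * b G (I - x)) + ∑[ x ∈ allFin n ] (𝟙 (lookup (W ─ N[ G , I ]) x) * b G I)
      ≡⟨ cong₂ _+_ (b-recurrence I)
                   (trans (≡.sym (*-distribʳ-∑ (b G I) (allFin n) _)) (cong (_* b G I) (≡.sym (∣p∣≡∑ W─N)))) ⟩
    ℕtoℚ ∣ N[ G , I ] ∣ * b G I + ℕtoℚ ∣ W─N ∣ * b G I
      ≡⟨ ≡.sym (ℚ.*-distribʳ-+ (b G I) (ℕtoℚ ∣ N[ G , I ] ∣) (ℕtoℚ ∣ W─N ∣)) ⟩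
    (ℕtoℚ ∣ N[ G , I ] ∣ + ℕtoℚ ∣ W─N ∣) * b G I
      ≡⟨ cong (_* b G I) (trans (ℚ.+-comm (ℕtoℚ ∣ N[ G , I ] ∣) _) (≡.sym (ℕtoℚ-+ ∣ W─N ∣ _))) ⟩
    ℕtoℚ (∣ W─N ∣ ℕ.+ ∣ N[ G , I ] ∣) * b G I
      ≡⟨ cong (λ t → ℕtoℚ t * b G I) (∣p─q∣+∣q∣≡∣p∣ W N[ G , I ] N[I]⊆W) ⟩
    ℕtoℚ ∣ W ∣ * b G I ∎
    where
    open ≡-Reasoning
    W─N : Subset n
    W─N = W ─ N[ G , I ]

  count≡!*b : ∀ k W I → ∣ W ∣ ≡ k → Independent G I → N[ G , I ] ⊆ W → count k W I ≡ ℕtoℚ (k !) * b G I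

  count-after : ∀ k W I x → ∣ W - x ∣ ≡ k → Independent G I → N[ G , I ] ⊆ W →
    count k (W - x) I ≡ ℕtoℚ (k !) * (𝟙 (lookup I x) * b G (I - x) + 𝟙 (not (lookup N[ G , I ] x)) * b G I)
  count-after k W I x ∣W-x∣≡k indep N[I]⊆W
    with lookup I x in x∈I | lookup (N G I) x in x∈NI | lookup-∪ I (N G I) x
  ... | true | _ | x∈N[I] rewrite x∈N[I] =
    trans (count-restrict k W I x ∣W-x∣≡k)
    (trans (count≡!*b k (W - x) (I - x) ∣W-x∣≡k (independent-⊆ (p-x⊆p I x) indep)
              (⊆-− N[ G , I - x ] W x
                   (⊆-trans N[ G , I - x ] N[ G , I ] W (N[]-mono (I - x) I (p-x⊆p I x)) N[I]⊆W)
                   (x∉N[I-x] I x indep x∈I)))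
           (cong (ℕtoℚ (k !) *_)
                 (solve 2 (λ p q → p := con 1ℚ :* p :+ con 0ℚ :* q) refl (b G (I - x)) (b G I))))
  ... | false | true | x∈N[I] rewrite x∈N[I] =
    trans (count-blocked k W I x ∣W-x∣≡k N[I]⊆W x∈I x∈NI)
          (solve 3 (λ K p q → con 0ℚ := K :* (con 0ℚ :* p :+ con 0ℚ :* q)) refl
                   (ℕtoℚ (k !)) (b G (I - x)) (b G I))
  ... | false | false | x∉N[I] rewrite x∉N[I] =
    trans (count≡!*b k (W - x) I ∣W-x∣≡k indep (⊆-− N[ G , I ] W x N[I]⊆W x∉N[I]))
          (cong (ℕtoℚ (k !) *_)
                (solve 2 (λ p q → q := con 0ℚ :* p :+ con 1ℚ :* q) refl (b G (I - x)) (b G I)))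

  count-step : ∀ k W I x → ∣ W ∣ ≡ suc k → Independent G I → N[ G , I ] ⊆ W →
    𝟙 (lookup W x) * count k (W - x) I ≡
    ℕtoℚ (k !) * (𝟙 (lookup I x) * b G (I - x) + 𝟙 (lookup (W ─ N[ G , I ]) x) * b G I)
  count-step k W I x ∣W∣≡1+k indep N[I]⊆W rewrite lookup-─ W N[ G , I ] x with lookup W x in x∈W
  ... | true  = trans (ℚ.*-identityˡ _) (count-after k W I x (∣p-x∣≡k W x x∈W ∣W∣≡1+k) indep N[I]⊆W)
  ... | false rewrite ⊆-lookup-false I W (N[I]⊆W⇒I⊆W I W N[I]⊆W) x x∈W =
    solve 4 (λ c K p q → con 0ℚ :* c := K :* (con 0ℚ :* p :+ con 0ℚ :* q)) refl
      (count k (W - x) I) (ℕtoℚ (k !)) (b G (I - x)) (b G I)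

  count≡!*b zero W I ∣W∣≡0 indep N[I]⊆W
    rewrite lookup≡false⇒∣p∣≡0 I λ v →
              ⊆-lookup-false I W (N[I]⊆W⇒I⊆W I W N[I]⊆W) v (∣p∣≡0⇒lookup≡false W ∣W∣≡0 v)
    = refl
  count≡!*b (suc k) W I ∣W∣≡1+k indep N[I]⊆W = begin
    count (suc k) W I
      ≡⟨ count-suc k W I N[I]⊆W ⟩
    ∑[ x ∈ allFin n ] (𝟙 (lookup W x) * count k (W - x) I)
      ≡⟨ ∑-cong (allFin n) (λ x → count-step k W I x ∣W∣≡1+k indep N[I]⊆W) ⟩
    ∑[ x ∈ allFin n ] (K * (𝟙 (lookup I x) * b G (I - x) + 𝟙 (lookup (W ─ N[ G , I ]) x) * b G I))
      ≡⟨ ≡.sym (*-distribˡ-∑ K (allFin n) _) ⟩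
    K * ∑[ x ∈ allFin n ] (𝟙 (lookup I x) * b G (I - x) + 𝟙 (lookup (W ─ N[ G , I ]) x) * b G I)
      ≡⟨ cong (K *_) (∑-first-choice W I N[I]⊆W) ⟩
    K * (ℕtoℚ ∣ W ∣ * b G I)
      ≡⟨ cong (λ t → K * (ℕtoℚ t * b G I)) ∣W∣≡1+k ⟩
    K * (ℕtoℚ (suc k) * b G I)
      ≡⟨ solve 3 (λ K m p → K :* (m :* p) := (m :* K) :* p) refl K (ℕtoℚ (suc k)) (b G I) ⟩
    ℕtoℚ (suc k) * K * b G I
      ≡⟨ cong (_* b G I) (≡.sym (ℕtoℚ-* (suc k) (k !))) ⟩
    ℕtoℚ (suc k !) * b G I ∎
    where
    open ≡-Reasoning
    K : ℚ
    K = ℕtoℚ (k !)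

module _ {m} (G : Graph (suc m)) where

  ∑-first-vertex : ∀ I → Independent G I →
    ∑[ x ∈ allFin (suc m) ] (𝟙 (I ⊆ᵇ (⊤ - x)) * count G m (⊤ - x) I) ≡
    ℕtoℚ (m !) * (ℕtoℚ (a G I) * b G I)
  ∑-first-vertex I indep = begin
    ∑[ x ∈ allFin (suc m) ] (𝟙 (I ⊆ᵇ (⊤ - x)) * count G m (⊤ - x) I)
      ≡⟨ ∑-cong (allFin (suc m)) term ⟩
    ∑[ x ∈ allFin (suc m) ] (K * (𝟙 (not (lookup N[ G , I ] x)) * b G I))
      ≡⟨ ≡.sym (*-distribˡ-∑ K (allFin (suc m)) (λ x → 𝟙 (not (lookup N[ G , I ] x)) * b G I)) ⟩
    K * ∑[ x ∈ allFin (suc m) ] (𝟙 (not (lookup N[ G , I ] x)) * b G I)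
      ≡⟨ cong (K *_) (≡.sym (*-distribʳ-∑ (b G I) (allFin (suc m)) (λ x → 𝟙 (not (lookup N[ G , I ] x))))) ⟩
    K * (∑[ x ∈ allFin (suc m) ] 𝟙 (not (lookup N[ G , I ] x)) * b G I)
      ≡⟨ cong (λ t → K * (t * b G I)) (≡.sym a≡∑) ⟩
    K * (ℕtoℚ (a G I) * b G I) ∎
    where
    open ≡-Reasoning
    K : ℚ
    K = ℕtoℚ (m !)
    a≡∑ : ℕtoℚ (a G I) ≡ ∑[ x ∈ allFin (suc m) ] 𝟙 (not (lookup N[ G , I ] x))
    a≡∑ = trans (∣p∣≡∑ (∁ N[ G , I ])) (∑-cong (allFin (suc m)) (λ x → cong 𝟙 (lookup-∁ N[ G , I ] x)))
    term : ∀ x → 𝟙 (I ⊆ᵇ (⊤ - x)) * count G m (⊤ - x) I ≡ K * (𝟙 (not (lookup N[ G , I ] x)) * b G I)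
    term x rewrite ⊆ᵇ-⊤-x I x with lookup I x in x∈I
    ... | true rewrite I⊆N[I] G I x x∈I =
      solve 3 (λ c K p → con 0ℚ :* c := K :* (con 0ℚ :* p)) refl (count G m (⊤ - x) I) K (b G I)
    ... | false = begin
      1ℚ * count G m (⊤ - x) I
        ≡⟨ ℚ.*-identityˡ _ ⟩
      count G m (⊤ - x) I
        ≡⟨ count-after G m ⊤ I x (∣⊤-x∣≡m x) indep (λ i _ → lookup-⊤ i) ⟩
      K * (𝟙 (lookup I x) * b G (I - x) + 𝟙 (not (lookup N[ G , I ] x)) * b G I)
        ≡⟨ cong (λ t → K * (𝟙 t * b G (I - x) + 𝟙 (not (lookup N[ G , I ] x)) * b G I)) x∈I ⟩
      K * (0ℚ * b G (I - x) + 𝟙 (not (lookup N[ G , I ] x)) * b G I)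
        ≡⟨ cong (K *_) (solve 2 (λ p q → con 0ℚ :* p :+ q := q) refl (b G (I - x)) _) ⟩
      K * (𝟙 (not (lookup N[ G , I ] x)) * b G I) ∎

  does-successive≡successiveAfter : ∀ x w → w ∈ₗ arrangements m (⊤ - x) →
    does (IsSuccessive? G (toOrdering (x ∷ w))) ≡ successiveAfter G ⁅ x ⁆ w
  does-successive≡successiveAfter x w w∈ = ≡-by-truth
    (λ successive →
      successiveAfter⁺ G ⁅ x ⁆ w (unique e) (from-ordering (does-true⁻ (IsSuccessive? G π) successive)))
    (λ successive → dec-true (IsSuccessive? G π) (to-ordering (successiveAfter⁻ G ⁅ x ⁆ w successive)))
    where
    π : Ordering (suc m)
    π = toOrdering (x ∷ w)
    e : Enumerates (⊤ - x) w
    e = arrangements⁻ m (⊤ - x) (∣⊤-x∣≡m x) w∈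
    e′ : Enumerates ⊤ (x ∷ w)
    e′ = enumerates-∷⁺ (lookup-⊤ x) e
    ∣x∷w∣≡ : length (x ∷ w) ≡ suc m
    ∣x∷w∣≡ = cong suc (length-arrangements m (⊤ - x) w∈)
    toℕ-π : ∀ v → toℕ (lookup π v) ≡ position (x ∷ w) v
    toℕ-π v = toℕ-toOrdering ∣x∷w∣≡ (complete e′ v (lookup-⊤ v))
    ∈w⇒≢x : ∀ {v} → v ∈ₗ w → v ≢ x
    ∈w⇒≢x v∈w refl = not-¬ (sound e v∈w) (lookup-−-self ⊤ x)
    from-ordering : IsSuccessive G π → ∀ {v} → v ∈ₗ w → HasEarlierNeighbour G ⁅ x ⁆ w v
    from-ordering successive {v} v∈w
      with successive v
             (≡.subst (0 ℕ.<_) (≡.sym (trans (toℕ-π v) (position-there w (∈w⇒≢x v∈w)))) (ℕ.s≤s ℕ.z≤n))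
    ... | u , u~v , u<v with u ≟ x
    ...   | yes refl = inj₁ (lookup-N⁺ G (lookup-⁅x⁆-x u) u~v)
    ...   | no u≢x   = inj₂ (u , u~v , ℕ.≤-pred (≡.subst₂ ℕ._<_
                           (trans (toℕ-π u) (position-there w u≢x))
                           (trans (toℕ-π v) (position-there w (∈w⇒≢x v∈w))) u<v))
    to-ordering : (∀ {v} → v ∈ₗ w → HasEarlierNeighbour G ⁅ x ⁆ w v) → IsSuccessive G π
    to-ordering earlier v 0<π[v] with v ≟ x
    ... | yes refl = ⊥-elim (ℕ.n≮0 (≡.subst (0 ℕ.<_) (trans (toℕ-π v) (position-here v w)) 0<π[v]))
    ... | no v≢x with earlier (complete e v (trans (lookup-−-other ⊤ v≢x) (lookup-⊤ v)))
    ...   | inj₁ v∈N⁅x⁆ = let (u , u∈⁅x⁆ , u~v) = lookup-N⁻ G v∈N⁅x⁆ in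
      u , u~v , ≡.subst (ℕ._< toℕ (lookup π v))
                        (≡.sym (trans (toℕ-π u) (trans (cong (position (x ∷ w)) (lookup-⁅⁆⁻ u∈⁅x⁆))
                                                       (position-here x w))))
                        0<π[v]
    ...   | inj₂ (u , u~v , u<v) =
      u , u~v , ≡.subst₂ ℕ._<_ (≡.sym (toℕ-π u)) (≡.sym (trans (toℕ-π v) (position-there w v≢x)))
                          (ℕ.≤-<-trans (position-∷-≤ x u w) (ℕ.s≤s u<v))

  σ≡#successive-arrangements :
    σ G ≡ length (filter (λ w → IsSuccessive? G (toOrdering w)) (arrangements (suc m) ⊤))
  σ≡#successive-arrangements =
    trans (unique-length (Unique.filter⁺ P? (allVecs-unique (suc m) (suc m)))
                         (Unique-map-on toOrdering same-ordering
                                        (Unique.filter⁺ Q? (arrangements-unique (suc m) ⊤)))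
                         to from)
          (Listₚ.length-map toOrdering successive)
    where
    P? : ∀ π → Dec (IsBijection π × IsSuccessive G π)
    P? π = IsBijection? π ×-dec IsSuccessive? G π
    Q? : ∀ w → Dec (IsSuccessive G (toOrdering w))
    Q? w = IsSuccessive? G (toOrdering w)
    successive : List (List (Fin (suc m)))
    successive = filter Q? (arrangements (suc m) ⊤)
    full : ∀ {w} → w ∈ₗ successive → w ∈ₗ arrangements (suc m) ⊤ × IsSuccessive G (toOrdering w)
    full = ∈-filter⁻ Q? {xs = arrangements (suc m) ⊤}
    enumerates : ∀ {w} → w ∈ₗ arrangements (suc m) ⊤ → Enumerates ⊤ w
    enumerates = arrangements⁻ (suc m) ⊤ (Subset.∣⊤∣≡n (suc m))
    same-ordering : ∀ {w w′} → w ∈ₗ successive → w′ ∈ₗ successive →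
                    toOrdering w ≡ toOrdering w′ → w ≡ w′
    same-ordering w∈ w′∈ = let (w∈A , _) = full w∈ ; (w′∈A , _) = full w′∈ in
      toOrdering-injective (enumerates w∈A) (length-arrangements (suc m) ⊤ w∈A)
                           (enumerates w′∈A) (length-arrangements (suc m) ⊤ w′∈A)
    to : ∀ {π} → π ∈ₗ filter P? (allVecs (suc m) (suc m)) → π ∈ₗ map toOrdering successive
    to {π} π∈ with ∈-filter⁻ P? {xs = allVecs (suc m) (suc m)} π∈
    ... | _ , bijective , succ with toOrdering-surjective π bijective
    ...   | w , w∈A , refl = ∈-map⁺ toOrdering (∈-filter⁺ Q? w∈A succ)
    from : ∀ {π} → π ∈ₗ map toOrdering successive → π ∈ₗ filter P? (allVecs (suc m) (suc m))
    from π∈ with ∈-map⁻ toOrdering π∈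
    ... | w , w∈ , refl = let (w∈A , succ) = full w∈ in
      ∈-filter⁺ P? (∈-allVecs (suc m) (suc m) (toOrdering w))
        (toOrdering-bijective (enumerates w∈A) (length-arrangements (suc m) ⊤ w∈A) , succ)

  σ≡∑ : ℕtoℚ (σ G) ≡
        ∑[ x ∈ allFin (suc m) ] ∑[ w ∈ arrangements m (⊤ - x) ] 𝟙 (successiveAfter G (∁ (⊤ - x)) w)
  σ≡∑ = begin
    ℕtoℚ (σ G)
      ≡⟨ cong ℕtoℚ σ≡#successive-arrangements ⟩
    ℕtoℚ (length (filter (λ w → IsSuccessive? G (toOrdering w)) (arrangements (suc m) ⊤)))
      ≡⟨ length-filter (λ w → IsSuccessive? G (toOrdering w)) (arrangements (suc m) ⊤) ⟩
    ∑[ w ∈ arrangements (suc m) ⊤ ] 𝟙 (does (IsSuccessive? G (toOrdering w)))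
      ≡⟨ ∑-arrangements m ⊤ _ ⟩
    ∑[ x ∈ allFin (suc m) ]
      (𝟙 (lookup ⊤ x) * ∑[ w ∈ arrangements m (⊤ - x) ] 𝟙 (does (IsSuccessive? G (toOrdering (x ∷ w)))))
      ≡⟨ ∑-cong (allFin (suc m)) first-vertex ⟩
    ∑[ x ∈ allFin (suc m) ] ∑[ w ∈ arrangements m (⊤ - x) ] 𝟙 (successiveAfter G (∁ (⊤ - x)) w) ∎
    where
    open ≡-Reasoning
    first-vertex : ∀ x →
      𝟙 (lookup ⊤ x) * ∑[ w ∈ arrangements m (⊤ - x) ] 𝟙 (does (IsSuccessive? G (toOrdering (x ∷ w)))) ≡
      ∑[ w ∈ arrangements m (⊤ - x) ] 𝟙 (successiveAfter G (∁ (⊤ - x)) w)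
    first-vertex x rewrite lookup-⊤ x | ∁[⊤-x]≡⁅x⁆ x =
      trans (ℚ.*-identityˡ _)
            (∑-cong-∈ (arrangements m (⊤ - x)) (λ w∈ → cong 𝟙 (does-successive≡successiveAfter x _ w∈)))

  ∑-successive≡∑-independent :
    ∑[ x ∈ allFin (suc m) ] ∑[ w ∈ arrangements m (⊤ - x) ] 𝟙 (successiveAfter G (∁ (⊤ - x)) w) ≡
    ∑[ I ∈ filter (Independent? G) (allSubsets (suc m)) ] (sgn ∣ I ∣ * (ℕtoℚ (m !) * (ℕtoℚ (a G I) * b G I)))
  ∑-successive≡∑-independent = begin
    ∑[ x ∈ allFin (suc m) ] ∑[ w ∈ arrangements m (⊤ - x) ] 𝟙 (successiveAfter G (∁ (⊤ - x)) w)
      ≡⟨ ∑-cong (allFin (suc m)) (λ x → ∑-successiveAfter G m (⊤ - x) (∣⊤-x∣≡m x)) ⟩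
    ∑[ x ∈ allFin (suc m) ] ∑[ I ∈ subsets ] (s I * (d I * (𝟙 (I ⊆ᵇ (⊤ - x)) * count G m (⊤ - x) I)))
      ≡⟨ ∑-comm (allFin (suc m)) subsets _ ⟩
    ∑[ I ∈ subsets ] ∑[ x ∈ allFin (suc m) ] (s I * (d I * (𝟙 (I ⊆ᵇ (⊤ - x)) * count G m (⊤ - x) I)))
      ≡⟨ ∑-cong subsets pull-out ⟩
    ∑[ I ∈ subsets ] (s I * (d I * ∑[ x ∈ allFin (suc m) ] (𝟙 (I ⊆ᵇ (⊤ - x)) * count G m (⊤ - x) I)))
      ≡⟨ ∑-cong subsets (λ I → cong (s I *_) (𝟙-does-*-cong (Independent? G I) (∑-first-vertex I))) ⟩
    ∑[ I ∈ subsets ] (s I * (d I * T I))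
      ≡⟨ ∑-cong subsets (λ I → solve 3 (λ s d t → s :* (d :* t) := d :* (s :* t)) refl (s I) (d I) (T I)) ⟩
    ∑[ I ∈ subsets ] (d I * (s I * T I))
      ≡⟨ ≡.sym (∑-filter (Independent? G) subsets (λ I → s I * T I)) ⟩
    ∑[ I ∈ filter (Independent? G) subsets ] (s I * T I) ∎
    where
    open ≡-Reasoning
    subsets : List (Subset (suc m))
    subsets = allSubsets (suc m)
    s d T : Subset (suc m) → ℚ
    s I = sgn ∣ I ∣
    d I = 𝟙 (does (Independent? G I))
    T I = ℕtoℚ (m !) * (ℕtoℚ (a G I) * b G I)
    pull-out : ∀ I → ∑[ x ∈ allFin (suc m) ] (s I * (d I * (𝟙 (I ⊆ᵇ (⊤ - x)) * count G m (⊤ - x) I))) ≡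
                     s I * (d I * ∑[ x ∈ allFin (suc m) ] (𝟙 (I ⊆ᵇ (⊤ - x)) * count G m (⊤ - x) I))
    pull-out I = trans (≡.sym (*-distribˡ-∑ (s I) (allFin (suc m)) _))
                       (cong (s I *_) (≡.sym (*-distribˡ-∑ (d I) (allFin (suc m)) _)))

theorem1p2 : (m : ℕ) (G : Graph (suc m)) → Connected G →
    ℕtoℚ (σ G) ≡ ℕtoℚ ((suc m) !) * alternatingSum G
theorem1p2 m G _ = begin
  ℕtoℚ (σ G)
    ≡⟨ σ≡∑ G ⟩
  ∑[ x ∈ allFin (suc m) ] ∑[ w ∈ arrangements m (⊤ - x) ] 𝟙 (successiveAfter G (∁ (⊤ - x)) w)
    ≡⟨ ∑-successive≡∑-independent G ⟩
  ∑[ I ∈ independentSets ] (sgn ∣ I ∣ * (ℕtoℚ (m !) * (ℕtoℚ (a G I) * b G I)))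
    ≡⟨ ∑-cong independentSets (λ I → ≡.sym (alternating-term m (sgn ∣ I ∣) (a G I) (b G I))) ⟩
  ∑[ I ∈ independentSets ] (ℕtoℚ (suc m !) * (sgn ∣ I ∣ * ((ℤ.+ a G I / suc m) * b G I)))
    ≡⟨ ≡.sym (*-distribˡ-∑ (ℕtoℚ (suc m !)) independentSets _) ⟩
  ℕtoℚ (suc m !) * alternatingSum G ∎
  where
  open ≡-Reasoning
  independentSets : List (Subset (suc m))
  independentSets = filter (Independent? G) (allSubsets (suc m))
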